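{- Let $(\alpha_n(a,k,q),\beta_n(a,k,q))_{n\ge0}$ satisfy, for all parameters $a,k$, all bases $q$, and all $n\ge0$, \[ \beta_{n}(a,k,q) = \sum_{j=0}^{n}\frac{(k/a;q)_{n-j}(k;q)_{n+j}}{(q;q)_{n-j}(aq;q)_{n+j}}\alpha_{j}(a,k,q). \] Let $(g_n)$ be an arbitrary sequence and $e,c$ arbitrary constants. Define $\alpha_{2n}'(a,k,q) = g_n\alpha_n(e,c,q^2)$, $\alpha_{2n+1}'(a,k,q)=0$, and \[ \beta_{n}'(a,k,q)= \sum_{j=0}^{n}\beta_{j}(e,c,q^2)\frac{(1-c q^{4j})\left(\frac{k}{a};q\right)_{n-2j}(k;q)_{n+2j}(eq^2;q^2)_{2j}}{(1-c)(q;q)_{n-2j}(aq;q)_{n+2j}(cq^2;q^2)_{2j}} \sum_{r=0}^{\lfloor n/2 \rfloor-j}\frac{(1-eq^{4j+4r})(q^{ -(n-2j)},kq^{n+2j};q)_{2r}(e/c,eq^{4j};q^2)_r\, g_{r+j}}{(1-e q^{4j})(a q^{n+2j+1},a q^{1-(n-2j)}/k;q)_{2r}(cq^{4j+2},q^2;q^2)_r}\left(\frac{q^2 c a^2}{k^2 e}\right)^r, \] where for $j>\lfloor n/2\rfloor$ the inner sum is empty and the corresponding term is $0$. Then $(\alpha_n'(a,k,q),\beta_n'(a,k,q))$ satisfies the same relation in base $q$.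
   Context: $(x;q)_n=\prod_{i=0}^{n-1}(1-xq^i)$, $(x_1,\dots,x_m;q)_n=\prod_i(x_i;q)_n$. Parameters are generic so denominators are nonzero. -}

module Defs where

open import Level using (_⊔_) renaming (suc to lsuc)
open import Algebra.Bundles using (CommutativeRing)
open import Data.Nat using (ℕ; zero; suc; _∸_; _≤_) renaming (_+_ to _+ℕ_; _*_ to _*ℕ_; _/_ to _/ℕ_)
open import Relation.Nullary using (¬_)
open import Data.Product using (_×_)

-- The inverse is a total function; its value at 0#
-- is unconstrained and never used (every division in the statement comes with
-- a hypothesis that the divisor is nonzero).
record Field ℓ₁ ℓ₂ : Set (lsuc (ℓ₁ ⊔ ℓ₂)) where
  field
    commutativeRing : CommutativeRing ℓ₁ ℓ₂
  open CommutativeRing commutativeRing public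
  infix 8 _⁻¹
  field
    _⁻¹       : Carrier → Carrier
    ⁻¹-cong   : ∀ {x y} → x ≈ y → x ⁻¹ ≈ y ⁻¹
    ⁻¹-inverse : ∀ x → ¬ (x ≈ 0#) → x * x ⁻¹ ≈ 1#
    0≉1       : ¬ (0# ≈ 1#)

module FieldDefs {ℓ₁ ℓ₂} (F : Field ℓ₁ ℓ₂) where
  open Field F public

  NZ : Carrier → Set ℓ₂
  NZ x = ¬ (x ≈ 0#)

  infixr 9 _^_
  _^_ : Carrier → ℕ → Carrier
  x ^ zero  = 1#
  x ^ suc n = x ^ n * x

  poch : Carrier → Carrier → ℕ → Carrier
  poch x q zero    = 1#
  poch x q (suc n) = poch x q n * (1# - x * q ^ n)

  sumTo : ℕ → (ℕ → Carrier) → Carrier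
  sumTo zero    f = f 0
  sumTo (suc n) f = sumTo n f + f (suc n)

  BaileyRel : (α β : ℕ → Carrier → Carrier → Carrier → Carrier) →
              Carrier → Carrier → Carrier → ℕ → Set ℓ₂
  BaileyRel α β a k q n =
    β n a k q ≈ sumTo n (λ j →
      poch (k * a ⁻¹) q (n ∸ j) * poch k q (n +ℕ j)
        * (poch q q (n ∸ j) * poch (a * q) q (n +ℕ j)) ⁻¹
        * α j a k q)

  RelGeneric : Carrier → Carrier → Carrier → ℕ → Set ℓ₂
  RelGeneric a k q n =
    NZ a × (∀ j → j ≤ n → NZ (poch q q (n ∸ j) * poch (a * q) q (n +ℕ j)))

  -- α'_{2m} = g_m α_m(e,c,q²),  α'_{2m+1} = 0
  evenPart : ℕ → (ℕ → Carrier) → Carrier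
  evenPart zero          f = f 0
  evenPart (suc zero)    f = 0#
  evenPart (suc (suc n)) f = evenPart n (λ m → f (suc m))

  αPrime : (g : ℕ → Carrier) (α : ℕ → Carrier → Carrier → Carrier → Carrier)
           (e c : Carrier) → ℕ → Carrier → Carrier → Carrier → Carrier
  αPrime g α e c n a k q = evenPart n (λ m → g m * α m e c (q * q))

  outerDen : (e c a k q : Carrier) (n j : ℕ) → Carrier
  outerDen e c a k q n j =
    (1# - c) * poch q q (n ∸ 2 *ℕ j) * poch (a * q) q (n +ℕ 2 *ℕ j)
      * poch (c * (q * q)) (q * q) (2 *ℕ j)

  innerDen : (e c a k q : Carrier) (n j r : ℕ) → Carrier
  innerDen e c a k q n j r =
    (1# - e * q ^ (4 *ℕ j))
      * poch (a * q ^ (n +ℕ 2 *ℕ j +ℕ 1)) q (2 *ℕ r)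
      * poch (a * q * (q ⁻¹) ^ (n ∸ 2 *ℕ j) * k ⁻¹) q (2 *ℕ r)
      * poch (c * q ^ (4 *ℕ j +ℕ 2)) (q * q) r
      * poch (q * q) (q * q) r

  βPrime : (g : ℕ → Carrier) (β : ℕ → Carrier → Carrier → Carrier → Carrier)
           (e c : Carrier) → ℕ → Carrier → Carrier → Carrier → Carrier
  βPrime g β e c n a k q =
    sumTo (n /ℕ 2) (λ j →
      β j e c (q * q)
        * ((1# - c * q ^ (4 *ℕ j)) * poch (k * a ⁻¹) q (n ∸ 2 *ℕ j)
             * poch k q (n +ℕ 2 *ℕ j) * poch (e * (q * q)) (q * q) (2 *ℕ j))
        * (outerDen e c a k q n j) ⁻¹
        * sumTo (n /ℕ 2 ∸ j) (λ r →
            (1# - e * q ^ (4 *ℕ j +ℕ 4 *ℕ r))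
              * poch ((q ⁻¹) ^ (n ∸ 2 *ℕ j)) q (2 *ℕ r)
              * poch (k * q ^ (n +ℕ 2 *ℕ j)) q (2 *ℕ r)
              * poch (e * c ⁻¹) (q * q) r
              * poch (e * q ^ (4 *ℕ j)) (q * q) r
              * g (r +ℕ j)
              * (innerDen e c a k q n j r) ⁻¹
              * ((q * q * c * a * a) * (k * k * e) ⁻¹) ^ r))

  PrimeGeneric : (e c a k q : Carrier) → ℕ → Set ℓ₂
  PrimeGeneric e c a k q n =
    NZ q × NZ k × NZ e × NZ c
    × RelGeneric a k q n
    × (∀ j → j ≤ n /ℕ 2 → RelGeneric e c (q * q) j)
    × (∀ j → j ≤ n /ℕ 2 → NZ (outerDen e c a k q n j))
    × (∀ j r → j ≤ n /ℕ 2 → r ≤ n /ℕ 2 ∸ j → NZ (innerDen e c a k q n j r))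

{-# OPTIONS --safe #-}
-- Substituting the relation for β_j(e,c,q²) into β′_n and collecting the coefficient of
-- g_m α_i(e,c,q²) gives a triple sum over i ≤ j ≤ m = j + r ≤ ⌊n/2⌋.  Each term splits into
-- a factor involving a and k and a factor involving only e, c and p = q².  Moving from
-- (j, r) to (j + 1, r − 1) multiplies the first by c/e, so it equals the Bailey coefficient
-- of index 2m times (c/e)^r.  The second, with L = m − i and s = j − i, is the s-th summand
-- of a terminating well-poised sum in base p with
-- parameters w = c/e and E = e p^{2i}; that sum is 1 for L = 0 and vanishes for L ≥ 1,
-- because its partial sums have a closed form whose last value is 0.  Only i = m survives,
-- leaving Σ_m (k/a)_{n−2m}(k)_{n+2m}/((q)_{n−2m}(aq)_{n+2m}) g_m α_m(e,c,q²), which is the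
-- relation for α′ since α′ vanishes at odd indices.
module Submission where

open import Defs
open import Algebra.Bundles using (CommutativeRing)
open import Data.Nat as ℕ using (ℕ; zero; suc; _∸_; _≤_; _<_; z≤n; s≤s)
  renaming (_+_ to _+ℕ_; _*_ to _*ℕ_; _/_ to _/ℕ_)
import Data.Nat.Properties as ℕ
import Data.Nat.DivMod as ℕ
open import Data.Nat.Tactic.RingSolver using (solve-∀)
open import Data.Integer as ℤ using (ℤ; +_; -[1+_]; sign; ∣_∣; _⊖_; _◃_)
import Data.Integer.Properties as ℤ
open import Data.Sign as Sign using (Sign)
open import Data.Maybe using (Maybe; just; nothing)
open import Data.Product using (_,_; proj₂)
open import Relation.Binary.PropositionalEquality as ≡ using (_≡_; cong; cong₂)
open import Relation.Nullary using (yes; no)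

-- With the carrier itself as coefficient ring (as in Tactic.RingSolver) a constant such as
-- 1 - 1 does not normalise to 0 in an abstract ring; integer coefficients make it do so.
module IntegerCoefficientSolver {ℓ₁ ℓ₂} (R : CommutativeRing ℓ₁ ℓ₂) where
  open CommutativeRing R
  open import Relation.Binary.Reasoning.Setoid setoid
  open import Algebra.Properties.Ring ring using (-‿involutive; -0#≈0#; -1*x≈-x)
  open import Algebra.Properties.AbelianGroup +-abelianGroup using (⁻¹-∙-comm)
  open import Algebra.Properties.CommutativeSemigroup *-commutativeSemigroup using (interchange)
  open import Algebra.Properties.Semiring.Mult.TCOptimised semiring using (_×_; 1+×; ×-homo-+; ×1-homo-*)
  open import Algebra.Solver.Ring.AlmostCommutativeRing
    using (fromCommutativeRing; _-Raw-AlmostCommutative⟶_)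

  fromℤ : ℤ → Carrier
  fromℤ (+ n)    = n × 1#
  fromℤ -[1+ n ] = - (suc n × 1#)

  private
    -‿+-comm : ∀ x y → - x + - y ≈ - (x + y)
    -‿+-comm = ⁻¹-∙-comm

    1+x-[1+y]≈x-y : ∀ x y → (1# + x) - (1# + y) ≈ x - y
    1+x-[1+y]≈x-y x y = begin
      (1# + x) - (1# + y)       ≈⟨ +-congˡ (sym (-‿+-comm 1# y)) ⟩
      (1# + x) + (- 1# + - y)   ≈⟨ +-congʳ (+-comm 1# x) ⟩
      (x + 1#) + (- 1# + - y)   ≈⟨ +-assoc x 1# _ ⟩
      x + (1# + (- 1# + - y))   ≈⟨ +-congˡ (sym (+-assoc 1# (- 1#) (- y))) ⟩
      x + ((1# - 1#) + - y)     ≈⟨ +-congˡ (+-congʳ (-‿inverseʳ 1#)) ⟩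
      x + (0# + - y)            ≈⟨ +-congˡ (+-identityˡ (- y)) ⟩
      x - y                     ∎

  fromℤ-⊖ : ∀ m n → fromℤ (m ⊖ n) ≈ m × 1# - n × 1#
  fromℤ-⊖ m       zero    = sym (trans (+-congˡ -0#≈0#) (+-identityʳ _))
  fromℤ-⊖ zero    (suc n) = sym (+-identityˡ _)
  fromℤ-⊖ (suc m) (suc n) = begin
    fromℤ (suc m ⊖ suc n)          ≡⟨ cong fromℤ (ℤ.[1+m]⊖[1+n]≡m⊖n m n) ⟩
    fromℤ (m ⊖ n)                  ≈⟨ fromℤ-⊖ m n ⟩
    m × 1# - n × 1#                ≈⟨ sym (1+x-[1+y]≈x-y _ _) ⟩
    (1# + m × 1#) - (1# + n × 1#)  ≈⟨ sym (+-cong (1+× m 1#) (-‿cong (1+× n 1#))) ⟩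
    suc m × 1# - suc n × 1#        ∎

  fromℤ-+ : ∀ i j → fromℤ (i ℤ.+ j) ≈ fromℤ i + fromℤ j
  fromℤ-+ (+ m)    (+ n)    = ×-homo-+ 1# m n
  fromℤ-+ (+ m)    -[1+ n ] = fromℤ-⊖ m (suc n)
  fromℤ-+ -[1+ m ] (+ n)    = trans (fromℤ-⊖ n (suc m)) (+-comm _ _)
  fromℤ-+ -[1+ m ] -[1+ n ] = begin
    - (suc (suc (m ℕ.+ n)) × 1#)          ≡⟨ cong (λ t → - (t × 1#)) (ℕ.+-suc (suc m) n) ⟨
    - ((suc m ℕ.+ suc n) × 1#)            ≈⟨ -‿cong (×-homo-+ 1# (suc m) (suc n)) ⟩
    - (suc m × 1# + suc n × 1#)           ≈⟨ -‿+-comm _ _ ⟨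
    - (suc m × 1#) + - (suc n × 1#)       ∎

  private
    sgn : Sign → Carrier
    sgn Sign.+ = 1#
    sgn Sign.- = - 1#

    sgn-* : ∀ s t → sgn (s Sign.* t) ≈ sgn s * sgn t
    sgn-* Sign.+ t      = sym (*-identityˡ _)
    sgn-* Sign.- Sign.+ = sym (*-identityʳ _)
    sgn-* Sign.- Sign.- = sym (trans (-1*x≈-x (- 1#)) (-‿involutive 1#))

    fromℤ-◃ : ∀ s n → fromℤ (s ◃ n) ≈ sgn s * (n × 1#)
    fromℤ-◃ s       zero    = sym (zeroʳ _)
    fromℤ-◃ Sign.+ (suc n) = sym (*-identityˡ _)
    fromℤ-◃ Sign.- (suc n) = sym (-1*x≈-x _)

    fromℤ-sign : ∀ i → fromℤ i ≈ sgn (sign i) * (∣ i ∣ × 1#)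
    fromℤ-sign i = trans (reflexive (cong fromℤ (≡.sym (ℤ.◃-inverse i)))) (fromℤ-◃ (sign i) ∣ i ∣)

  fromℤ-* : ∀ i j → fromℤ (i ℤ.* j) ≈ fromℤ i * fromℤ j
  fromℤ-* i j = begin
    fromℤ (sign i Sign.* sign j ◃ ∣ i ∣ ℕ.* ∣ j ∣)            ≈⟨ fromℤ-◃ (sign i Sign.* sign j) (∣ i ∣ ℕ.* ∣ j ∣) ⟩
    sgn (sign i Sign.* sign j) * ((∣ i ∣ ℕ.* ∣ j ∣) × 1#)     ≈⟨ *-cong (sgn-* (sign i) (sign j)) (×1-homo-* ∣ i ∣ ∣ j ∣) ⟩
    (sgn (sign i) * sgn (sign j)) * ((∣ i ∣ × 1#) * (∣ j ∣ × 1#)) ≈⟨ interchange _ _ _ _ ⟩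
    (sgn (sign i) * (∣ i ∣ × 1#)) * (sgn (sign j) * (∣ j ∣ × 1#)) ≈⟨ *-cong (fromℤ-sign i) (fromℤ-sign j) ⟨
    fromℤ i * fromℤ j                                         ∎

  fromℤ-neg : ∀ i → fromℤ (ℤ.- i) ≈ - fromℤ i
  fromℤ-neg -[1+ n ]     = sym (-‿involutive _)
  fromℤ-neg (+ zero)     = sym -0#≈0#
  fromℤ-neg (+ (suc n))  = refl

  fromℤ-homomorphism : ℤ.+-*-rawRing -Raw-AlmostCommutative⟶ fromCommutativeRing R
  fromℤ-homomorphism = record
    { ⟦_⟧    = fromℤ
    ; +-homo = fromℤ-+
    ; *-homo = fromℤ-*
    ; -‿homo = fromℤ-neg
    ; 0-homo = refl
    ; 1-homo = refl
    }

  private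
    fromℤ-≟ : ∀ i j → Maybe (fromℤ i ≈ fromℤ j)
    fromℤ-≟ i j with i ℤ.≟ j
    ... | yes ≡.refl = just refl
    ... | no _     = nothing

  open import Algebra.Solver.Ring ℤ.+-*-rawRing (fromCommutativeRing R) fromℤ-homomorphism fromℤ-≟ public

  :0 :1 : ∀ {n} → Polynomial n
  :0 = con (+ 0)
  :1 = con (+ 1)

module FieldProperties {ℓ₁ ℓ₂} (F : Field ℓ₁ ℓ₂) where
  open FieldDefs F public
  open IntegerCoefficientSolver commutativeRing public using (solve; _:=_; _:+_; _:-_; _:*_; :0; :1)
  open import Relation.Binary.Reasoning.Setoid setoid public
  open import Algebra.Properties.CommutativeSemigroup *-commutativeSemigroup using (interchange)

  NZ-resp-≈ : ∀ {x y} → x ≈ y → NZ x → NZ y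
  NZ-resp-≈ x≈y x≉0 y≈0 = x≉0 (trans x≈y y≈0)

  NZ-1 : NZ 1#
  NZ-1 1≈0 = 0≉1 (sym 1≈0)

  NZ-*⇒NZˡ : ∀ {x y} → NZ (x * y) → NZ x
  NZ-*⇒NZˡ {y = y} xy≉0 x≈0 = xy≉0 (trans (*-congʳ x≈0) (zeroˡ y))

  NZ-*⇒NZʳ : ∀ {x y} → NZ (x * y) → NZ y
  NZ-*⇒NZʳ {x} xy≉0 y≈0 = xy≉0 (trans (*-congˡ y≈0) (zeroʳ x))

  ⁻¹-inverseʳ : ∀ {x} → NZ x → x * x ⁻¹ ≈ 1#
  ⁻¹-inverseʳ {x} = ⁻¹-inverse x

  ⁻¹-inverseˡ : ∀ {x} → NZ x → x ⁻¹ * x ≈ 1#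
  ⁻¹-inverseˡ x≉0 = trans (*-comm _ _) (⁻¹-inverseʳ x≉0)

  *-cancelʳ-≈ : ∀ {x y d} → NZ d → x * d ≈ y * d → x ≈ y
  *-cancelʳ-≈ {x} {y} {d} d≉0 xd≈yd = begin
    x                  ≈⟨ *-identityʳ x ⟨
    x * 1#             ≈⟨ *-congˡ (⁻¹-inverseʳ d≉0) ⟨
    x * (d * d ⁻¹)     ≈⟨ *-assoc x d _ ⟨
    (x * d) * d ⁻¹     ≈⟨ *-congʳ xd≈yd ⟩
    (y * d) * d ⁻¹     ≈⟨ *-assoc y d _ ⟩
    y * (d * d ⁻¹)     ≈⟨ *-congˡ (⁻¹-inverseʳ d≉0) ⟩
    y * 1#             ≈⟨ *-identityʳ y ⟩
    y                  ∎

  NZ-* : ∀ {x y} → NZ x → NZ y → NZ (x * y)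
  NZ-* {x} {y} x≉0 y≉0 xy≈0 = x≉0 (*-cancelʳ-≈ y≉0 (trans xy≈0 (sym (zeroˡ y))))

  ⁻¹-unique : ∀ {x y} → NZ x → x * y ≈ 1# → x ⁻¹ ≈ y
  ⁻¹-unique {x} {y} x≉0 xy≈1 = *-cancelʳ-≈ x≉0 (begin
    x ⁻¹ * x   ≈⟨ ⁻¹-inverseˡ x≉0 ⟩
    1#         ≈⟨ xy≈1 ⟨
    x * y      ≈⟨ *-comm x y ⟩
    y * x      ∎)

  ⁻¹-1 : 1# ⁻¹ ≈ 1#
  ⁻¹-1 = ⁻¹-unique NZ-1 (*-identityˡ 1#)

  ⁻¹-distrib-* : ∀ {x y} → NZ x → NZ y → (x * y) ⁻¹ ≈ x ⁻¹ * y ⁻¹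
  ⁻¹-distrib-* {x} {y} x≉0 y≉0 = ⁻¹-unique (NZ-* x≉0 y≉0) (begin
    (x * y) * (x ⁻¹ * y ⁻¹)     ≈⟨ interchange x y (x ⁻¹) (y ⁻¹) ⟩
    (x * x ⁻¹) * (y * y ⁻¹)     ≈⟨ *-cong (⁻¹-inverseʳ x≉0) (⁻¹-inverseʳ y≉0) ⟩
    1# * 1#                     ≈⟨ *-identityˡ 1# ⟩
    1#                          ∎)

  cross-multiply : ∀ {x d y e} → NZ d → NZ e → x * e ≈ y * d → x * d ⁻¹ ≈ y * e ⁻¹
  cross-multiply {x} {d} {y} {e} d≉0 e≉0 xe≈yd = *-cancelʳ-≈ (NZ-* d≉0 e≉0) (begin
    (x * d ⁻¹) * (d * e)          ≈⟨ solve 4 (λ x d' d e → (x :* d') :* (d :* e) := (x :* e) :* (d :* d')) refl x (d ⁻¹) d e ⟩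
    (x * e) * (d * d ⁻¹)          ≈⟨ *-cong xe≈yd (⁻¹-inverseʳ d≉0) ⟩
    (y * d) * 1#                  ≈⟨ *-congˡ (⁻¹-inverseʳ e≉0) ⟨
    (y * d) * (e * e ⁻¹)          ≈⟨ solve 4 (λ y d e e' → (y :* d) :* (e :* e') := (y :* e') :* (d :* e)) refl y d e (e ⁻¹) ⟩
    (y * e ⁻¹) * (d * e)          ∎)

  ^-cong : ∀ {x y} n → x ≈ y → x ^ n ≈ y ^ n
  ^-cong zero    x≈y = refl
  ^-cong (suc n) x≈y = *-cong (^-cong n x≈y) x≈y

  ^-distribˡ-+-* : ∀ x m n → x ^ (m +ℕ n) ≈ x ^ m * x ^ n
  ^-distribˡ-+-* x zero    n = sym (*-identityˡ _)
  ^-distribˡ-+-* x (suc m) n = begin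
    x ^ (m +ℕ n) * x        ≈⟨ *-congʳ (^-distribˡ-+-* x m n) ⟩
    (x ^ m * x ^ n) * x     ≈⟨ solve 3 (λ a b x → (a :* b) :* x := (a :* x) :* b) refl (x ^ m) (x ^ n) x ⟩
    (x ^ m * x) * x ^ n     ∎

  ^-distribʳ-* : ∀ x y n → (x * y) ^ n ≈ x ^ n * y ^ n
  ^-distribʳ-* x y zero    = sym (*-identityˡ 1#)
  ^-distribʳ-* x y (suc n) = begin
    (x * y) ^ n * (x * y)       ≈⟨ *-congʳ (^-distribʳ-* x y n) ⟩
    (x ^ n * y ^ n) * (x * y)   ≈⟨ interchange (x ^ n) (y ^ n) x y ⟩
    (x ^ n * x) * (y ^ n * y)   ∎

  ^-*-assoc : ∀ x m n → x ^ (m *ℕ n) ≈ (x ^ m) ^ n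
  ^-*-assoc x m zero    = reflexive (cong (x ^_) (ℕ.*-zeroʳ m))
  ^-*-assoc x m (suc n) = begin
    x ^ (m *ℕ suc n)          ≡⟨ cong (x ^_) (≡.trans (ℕ.*-suc m n) (ℕ.+-comm m (m *ℕ n))) ⟩
    x ^ (m *ℕ n +ℕ m)         ≈⟨ ^-distribˡ-+-* x (m *ℕ n) m ⟩
    x ^ (m *ℕ n) * x ^ m      ≈⟨ *-congʳ (^-*-assoc x m n) ⟩
    (x ^ m) ^ n * x ^ m       ∎

  ^-zeroˡ : ∀ n → 1# ^ n ≈ 1#
  ^-zeroˡ zero    = refl
  ^-zeroˡ (suc n) = trans (*-identityʳ _) (^-zeroˡ n)

  ⁻¹-^-inverseˡ : ∀ {x} n → NZ x → (x ⁻¹) ^ n * x ^ n ≈ 1#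
  ⁻¹-^-inverseˡ {x} n x≉0 = begin
    (x ⁻¹) ^ n * x ^ n    ≈⟨ ^-distribʳ-* _ _ n ⟨
    (x ⁻¹ * x) ^ n        ≈⟨ ^-cong n (⁻¹-inverseˡ x≉0) ⟩
    1# ^ n                ≈⟨ ^-zeroˡ n ⟩
    1#                    ∎

  poch-cong : ∀ {x y} q n → x ≈ y → poch x q n ≈ poch y q n
  poch-cong q zero    x≈y = refl
  poch-cong q (suc n) x≈y = *-cong (poch-cong q n x≈y) (+-congˡ (-‿cong (*-congʳ x≈y)))

  poch-+ : ∀ x q m n → poch x q (m +ℕ n) ≈ poch x q m * poch (x * q ^ m) q n
  poch-+ x q m zero = begin
    poch x q (m +ℕ 0)   ≡⟨ cong (poch x q) (ℕ.+-identityʳ m) ⟩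
    poch x q m          ≈⟨ *-identityʳ _ ⟨
    poch x q m * 1#     ∎
  poch-+ x q m (suc n) = begin
    poch x q (m +ℕ suc n)                                      ≡⟨ cong (poch x q) (ℕ.+-suc m n) ⟩
    poch x q (m +ℕ n) * (1# - x * q ^ (m +ℕ n))                ≈⟨ *-cong (poch-+ x q m n) (+-congˡ (-‿cong x[qᵐqⁿ])) ⟩
    (poch x q m * poch (x * q ^ m) q n) * (1# - (x * q ^ m) * q ^ n)  ≈⟨ *-assoc _ _ _ ⟩
    poch x q m * (poch (x * q ^ m) q n * (1# - (x * q ^ m) * q ^ n))  ∎
    where
    x[qᵐqⁿ] : x * q ^ (m +ℕ n) ≈ (x * q ^ m) * q ^ n
    x[qᵐqⁿ] = trans (*-congˡ (^-distribˡ-+-* q m n)) (sym (*-assoc _ _ _))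

  poch-suc : ∀ x q n → poch x q (suc n) ≈ (1# - x) * poch (x * q) q n
  poch-suc x q n = begin
    poch x q (1 +ℕ n)                     ≈⟨ poch-+ x q 1 n ⟩
    poch x q 1 * poch (x * q ^ 1) q n     ≈⟨ *-cong first-factor (poch-cong q n (*-congˡ (*-identityˡ q))) ⟩
    (1# - x) * poch (x * q) q n           ∎
    where
    first-factor : poch x q 1 ≈ 1# - x
    first-factor = trans (*-identityˡ _) (+-congˡ (-‿cong (*-identityʳ x)))

  poch-2+ : ∀ x q r → poch x q (2 *ℕ suc r) ≈ (1# - x) * ((1# - x * q) * poch (x * q * q) q (2 *ℕ r))
  poch-2+ x q r = begin
    poch x q (2 *ℕ suc r)                                  ≡⟨ cong (poch x q) (ℕ.*-suc 2 r) ⟩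
    poch x q (suc (suc (2 *ℕ r)))                          ≈⟨ poch-suc x q (suc (2 *ℕ r)) ⟩
    (1# - x) * poch (x * q) q (suc (2 *ℕ r))               ≈⟨ *-congˡ (poch-suc (x * q) q (2 *ℕ r)) ⟩
    (1# - x) * ((1# - x * q) * poch (x * q * q) q (2 *ℕ r)) ∎

  NZ-poch-≤ : ∀ x q {m n} → m ≤ n → NZ (poch x q n) → NZ (poch x q m)
  NZ-poch-≤ x q {m} {n} m≤n ≉0 = NZ-*⇒NZˡ (NZ-resp-≈ split ≉0)
    where
    split : poch x q n ≈ poch x q m * poch (x * q ^ m) q (n ∸ m)
    split = trans (reflexive (cong (poch x q) (≡.sym (ℕ.m+[n∸m]≡n m≤n)))) (poch-+ x q m (n ∸ m))

  NZ-poch-factor : ∀ x q {m n} → m < n → NZ (poch x q n) → NZ (1# - x * q ^ m)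
  NZ-poch-factor x q {m} m<n ≉0 = NZ-*⇒NZʳ (NZ-poch-≤ x q {suc m} m<n ≉0)

  sumTo-cong : ∀ n {f g} → (∀ i → i ≤ n → f i ≈ g i) → sumTo n f ≈ sumTo n g
  sumTo-cong zero    f≈g = f≈g 0 z≤n
  sumTo-cong (suc n) f≈g = +-cong (sumTo-cong n (λ i i≤n → f≈g i (ℕ.m≤n⇒m≤1+n i≤n))) (f≈g (suc n) ℕ.≤-refl)

  sumTo-+ : ∀ n f g → sumTo n (λ i → f i + g i) ≈ sumTo n f + sumTo n g
  sumTo-+ zero    f g = refl
  sumTo-+ (suc n) f g = begin
    sumTo n (λ i → f i + g i) + (f (suc n) + g (suc n))   ≈⟨ +-congʳ (sumTo-+ n f g) ⟩
    (sumTo n f + sumTo n g) + (f (suc n) + g (suc n))     ≈⟨ solve 4 (λ a b c d → (a :+ b) :+ (c :+ d) := (a :+ c) :+ (b :+ d)) refl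
                                                               (sumTo n f) (sumTo n g) (f (suc n)) (g (suc n)) ⟩
    (sumTo n f + f (suc n)) + (sumTo n g + g (suc n))     ∎

  *-distribˡ-sumTo : ∀ n x f → x * sumTo n f ≈ sumTo n (λ i → x * f i)
  *-distribˡ-sumTo zero    x f = refl
  *-distribˡ-sumTo (suc n) x f = trans (distribˡ _ _ _) (+-congʳ (*-distribˡ-sumTo n x f))

  *-distribʳ-sumTo : ∀ n x f → sumTo n f * x ≈ sumTo n (λ i → f i * x)
  *-distribʳ-sumTo n x f = trans (*-comm _ _) (trans (*-distribˡ-sumTo n x f) (sumTo-cong n (λ i _ → *-comm _ _)))

  sumTo-zero : ∀ n f → (∀ i → i ≤ n → f i ≈ 0#) → sumTo n f ≈ 0#
  sumTo-zero n f f≈0 = trans (sumTo-cong n f≈0) (sum-0s n)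
    where
    sum-0s : ∀ n → sumTo n (λ _ → 0#) ≈ 0#
    sum-0s zero    = refl
    sum-0s (suc n) = trans (+-identityʳ _) (sum-0s n)

  ⁻¹-distrib-*₃ : ∀ {x y z} → NZ (x * y * z) → (x * y * z) ⁻¹ ≈ x ⁻¹ * y ⁻¹ * z ⁻¹
  ⁻¹-distrib-*₃ ≉0 = trans (⁻¹-distrib-* (NZ-*⇒NZˡ ≉0) (NZ-*⇒NZʳ ≉0))
                           (*-congʳ (⁻¹-distrib-* (NZ-*⇒NZˡ (NZ-*⇒NZˡ ≉0)) (NZ-*⇒NZʳ (NZ-*⇒NZˡ ≉0))))

  ⁻¹-distrib-*₄ : ∀ {x y z u} → NZ (x * y * z * u) → (x * y * z * u) ⁻¹ ≈ x ⁻¹ * y ⁻¹ * z ⁻¹ * u ⁻¹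
  ⁻¹-distrib-*₄ ≉0 = trans (⁻¹-distrib-* (NZ-*⇒NZˡ ≉0) (NZ-*⇒NZʳ ≉0)) (*-congʳ (⁻¹-distrib-*₃ (NZ-*⇒NZˡ ≉0)))

  ⁻¹-distrib-*₅ : ∀ {x y z u v} → NZ (x * y * z * u * v) → (x * y * z * u * v) ⁻¹ ≈ x ⁻¹ * y ⁻¹ * z ⁻¹ * u ⁻¹ * v ⁻¹
  ⁻¹-distrib-*₅ ≉0 = trans (⁻¹-distrib-* (NZ-*⇒NZˡ ≉0) (NZ-*⇒NZʳ ≉0)) (*-congʳ (⁻¹-distrib-*₄ (NZ-*⇒NZˡ ≉0)))

  evenPart-2* : ∀ m (f : ℕ → Carrier) → evenPart (2 *ℕ m) f ≈ f m
  evenPart-2* zero    f = refl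
  evenPart-2* (suc m) f = trans (reflexive (cong (λ t → evenPart t f) (ℕ.*-suc 2 m))) (evenPart-2* m (λ i → f (suc i)))

  evenPart-1+2* : ∀ m (f : ℕ → Carrier) → evenPart (suc (2 *ℕ m)) f ≈ 0#
  evenPart-1+2* zero    f = refl
  evenPart-1+2* (suc m) f = trans (reflexive (cong (λ t → evenPart (suc t) f) (ℕ.*-suc 2 m))) (evenPart-1+2* m (λ i → f (suc i)))

  sumTo-evenPart-2* : ∀ m (h f : ℕ → Carrier) →
    sumTo (2 *ℕ m) (λ t → h t * evenPart t f) ≈ sumTo m (λ j → h (2 *ℕ j) * f j)
  sumTo-evenPart-2* zero    h f = refl
  sumTo-evenPart-2* (suc m) h f = begin
    sumTo (2 *ℕ suc m) T                                                   ≡⟨ cong (λ x → sumTo x T) (ℕ.*-suc 2 m) ⟩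
    sumTo (2 *ℕ m) T + T (suc (2 *ℕ m)) + T (suc (suc (2 *ℕ m)))
      ≈⟨ +-cong (+-cong (sumTo-evenPart-2* m h f) (trans (*-congˡ (evenPart-1+2* m f)) (zeroʳ _)))
                (*-cong (reflexive (cong h (≡.sym (ℕ.*-suc 2 m))))
                        (trans (reflexive (cong (λ t → evenPart t f) (≡.sym (ℕ.*-suc 2 m)))) (evenPart-2* (suc m) f))) ⟩
    sumTo m (λ j → h (2 *ℕ j) * f j) + 0# + h (2 *ℕ suc m) * f (suc m)   ≈⟨ +-congʳ (+-identityʳ _) ⟩
    sumTo m (λ j → h (2 *ℕ j) * f j) + h (2 *ℕ suc m) * f (suc m)        ∎
    where
    T : ℕ → Carrier
    T t = h t * evenPart t f

  sumTo-evenPart-1+2* : ∀ m (h f : ℕ → Carrier) →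
    sumTo (suc (2 *ℕ m)) (λ t → h t * evenPart t f) ≈ sumTo m (λ j → h (2 *ℕ j) * f j)
  sumTo-evenPart-1+2* m h f =
    trans (+-cong (sumTo-evenPart-2* m h f) (trans (*-congˡ (evenPart-1+2* m f)) (zeroʳ _))) (+-identityʳ _)

  sumTo-evenPart : ∀ n (h f : ℕ → Carrier) →
    sumTo n (λ t → h t * evenPart t f) ≈ sumTo (n /ℕ 2) (λ j → h (2 *ℕ j) * f j)
  sumTo-evenPart n h f with n ℕ.% 2 | ℕ.m≡m%n+[m/n]*n n 2 | ℕ.m%n<n n 2
  ... | zero        | n≡[n/2]*2   | _ = trans (reflexive (cong (λ x → sumTo x (λ t → h t * evenPart t f))
                                                             (≡.trans n≡[n/2]*2 (ℕ.*-comm (n /ℕ 2) 2))))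
                                              (sumTo-evenPart-2* (n /ℕ 2) h f)
  ... | suc zero    | n≡1+[n/2]*2 | _ = trans (reflexive (cong (λ x → sumTo x (λ t → h t * evenPart t f))
                                                             (≡.trans n≡1+[n/2]*2 (cong suc (ℕ.*-comm (n /ℕ 2) 2)))))
                                              (sumTo-evenPart-1+2* (n /ℕ 2) h f)
  ... | suc (suc _) | _           | s≤s (s≤s ())

  sumTo-by-antidiagonals : ∀ N (G : ℕ → ℕ → Carrier) →
    sumTo N (λ j → sumTo (N ∸ j) (G j)) ≈ sumTo N (λ m → sumTo m (λ j → G j (m ∸ j)))
  sumTo-by-antidiagonals zero    G = refl
  sumTo-by-antidiagonals (suc N) G = begin
    sumTo N (λ j → sumTo (suc N ∸ j) (G j)) + sumTo (N ∸ N) (G (suc N))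
      ≈⟨ +-cong (sumTo-cong N (λ j j≤N → reflexive (cong (λ t → sumTo t (G j)) (ℕ.+-∸-assoc 1 j≤N))))
                (reflexive (cong (λ t → sumTo t (G (suc N))) (ℕ.n∸n≡0 N))) ⟩
    sumTo N (λ j → sumTo (N ∸ j) (G j) + G j (suc (N ∸ j))) + G (suc N) 0
      ≈⟨ +-congʳ (sumTo-+ N _ _) ⟩
    (sumTo N (λ j → sumTo (N ∸ j) (G j)) + sumTo N (λ j → G j (suc (N ∸ j)))) + G (suc N) 0
      ≈⟨ +-assoc _ _ _ ⟩
    sumTo N (λ j → sumTo (N ∸ j) (G j)) + (sumTo N (λ j → G j (suc (N ∸ j))) + G (suc N) 0)
      ≈⟨ +-cong (sumTo-by-antidiagonals N G)
                (+-cong (sumTo-cong N (λ j j≤N → reflexive (cong (G j) (≡.sym (ℕ.+-∸-assoc 1 j≤N)))))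
                        (reflexive (cong (G (suc N)) (≡.sym (ℕ.n∸n≡0 N))))) ⟩
    sumTo N (λ m → sumTo m (λ j → G j (m ∸ j))) + sumTo (suc N) (λ j → G j (suc N ∸ j)) ∎

  sumTo-triangle-swap : ∀ m (H : ℕ → ℕ → Carrier) →
    sumTo m (λ j → sumTo j (H j)) ≈ sumTo m (λ i → sumTo (m ∸ i) (λ s → H (i +ℕ s) i))
  sumTo-triangle-swap m H = sym (trans (sumTo-by-antidiagonals m (λ i s → H (i +ℕ s) i))
    (sumTo-cong m (λ j _ → sumTo-cong j (λ i i≤j → reflexive (cong (λ t → H t i) (ℕ.m+[n∸m]≡n i≤j))))))

  1-≈-rescale : ∀ {S S′ P P′} → S * S′ ≈ 1# → S * P′ ≈ P → 1# - P ≈ S * (S′ - P′)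
  1-≈-rescale {S} {S′} {P} {P′} SS′≈1 SP′≈P = sym (begin
    S * (S′ - P′)       ≈⟨ solve 3 (λ S S′ P′ → S :* (S′ :- P′) := S :* S′ :- S :* P′) refl S S′ P′ ⟩
    S * S′ - S * P′     ≈⟨ +-cong SS′≈1 (-‿cong SP′≈P) ⟩
    1# - P              ∎)

  baileyCoeff : Carrier → Carrier → Carrier → ℕ → ℕ → Carrier
  baileyCoeff a k q n j = poch (k * a ⁻¹) q (n ∸ j) * poch k q (n +ℕ j) * (poch q q (n ∸ j) * poch (a * q) q (n +ℕ j)) ⁻¹

  fraction-*-fraction : ∀ {x d y e} → NZ d → NZ e → (x * d ⁻¹) * (y * e ⁻¹) ≈ (x * y) * (d * e) ⁻¹
  fraction-*-fraction {x} {d} {y} {e} d≉0 e≉0 = begin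
    (x * d ⁻¹) * (y * e ⁻¹)    ≈⟨ interchange x (d ⁻¹) y (e ⁻¹) ⟩
    (x * y) * (d ⁻¹ * e ⁻¹)    ≈⟨ *-congˡ (⁻¹-distrib-* d≉0 e≉0) ⟨
    (x * y) * (d * e) ⁻¹       ∎

  factor-fraction : ∀ {X D C x G d} → NZ G → NZ d → X ≈ C * x → D ≈ G * d →
                    X * D ⁻¹ ≈ (C * G ⁻¹) * (x * d ⁻¹)
  factor-fraction {X} {D} {C} {x} {G} {d} G≉0 d≉0 X≈Cx D≈Gd = begin
    X * D ⁻¹                   ≈⟨ *-cong X≈Cx (⁻¹-cong D≈Gd) ⟩
    (C * x) * (G * d) ⁻¹       ≈⟨ *-congˡ (⁻¹-distrib-* G≉0 d≉0) ⟩
    (C * x) * (G ⁻¹ * d ⁻¹)    ≈⟨ interchange C x (G ⁻¹) (d ⁻¹) ⟩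
    (C * G ⁻¹) * (x * d ⁻¹)    ∎

  add-fractions : ∀ {x y z Y Q u} → NZ Y → NZ Q → NZ u → x * Q + y * Y ≈ z * u →
                  x * (Y * u) ⁻¹ + y * (Q * u) ⁻¹ ≈ z * (Y * Q) ⁻¹
  add-fractions {x} {y} {z} {Y} {Q} {u} Y≉0 Q≉0 u≉0 numerators = *-cancelʳ-≈ (NZ-* (NZ-* Y≉0 Q≉0) u≉0) (begin
    (x * (Y * u) ⁻¹ + y * (Q * u) ⁻¹) * (Y * Q * u)
      ≈⟨ solve 8 (λ x y Y Q u i j k → (x :* i :+ y :* j) :* (Y :* Q :* u) := x :* Q :* ((Y :* u) :* i) :+ y :* Y :* ((Q :* u) :* j)) refl
           x y Y Q u ((Y * u) ⁻¹) ((Q * u) ⁻¹) ((Y * Q) ⁻¹) ⟩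
    x * Q * ((Y * u) * (Y * u) ⁻¹) + y * Y * ((Q * u) * (Q * u) ⁻¹)
      ≈⟨ +-cong (*-congˡ (⁻¹-inverseʳ (NZ-* Y≉0 u≉0))) (*-congˡ (⁻¹-inverseʳ (NZ-* Q≉0 u≉0))) ⟩
    x * Q * 1# + y * Y * 1#                  ≈⟨ +-cong (*-identityʳ _) (*-identityʳ _) ⟩
    x * Q + y * Y                            ≈⟨ numerators ⟩
    z * u                                    ≈⟨ *-identityʳ _ ⟨
    z * u * 1#                               ≈⟨ *-congˡ (⁻¹-inverseʳ (NZ-* Y≉0 Q≉0)) ⟨
    z * u * ((Y * Q) * (Y * Q) ⁻¹)
      ≈⟨ solve 5 (λ z u Y Q i → z :* u :* ((Y :* Q) :* i) := (z :* i) :* (Y :* Q :* u)) refl z u Y Q ((Y * Q) ⁻¹) ⟩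
    z * (Y * Q) ⁻¹ * (Y * Q * u)             ∎)

  add-fractions-to-zero : ∀ {x y D E} → NZ D → NZ E → x * E + y * D ≈ 0# → x * D ⁻¹ + y * E ⁻¹ ≈ 0#
  add-fractions-to-zero {x} {y} {D} {E} D≉0 E≉0 numerators = *-cancelʳ-≈ (NZ-* D≉0 E≉0) (begin
    (x * D ⁻¹ + y * E ⁻¹) * (D * E)
      ≈⟨ solve 6 (λ x y D E i j → (x :* i :+ y :* j) :* (D :* E) := x :* E :* (D :* i) :+ y :* D :* (E :* j)) refl x y D E (D ⁻¹) (E ⁻¹) ⟩
    x * E * (D * D ⁻¹) + y * D * (E * E ⁻¹)  ≈⟨ +-cong (*-congˡ (⁻¹-inverseʳ D≉0)) (*-congˡ (⁻¹-inverseʳ E≉0)) ⟩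
    x * E * 1# + y * D * 1#                  ≈⟨ +-cong (*-identityʳ _) (*-identityʳ _) ⟩
    x * E + y * D                            ≈⟨ numerators ⟩
    0#                                       ≈⟨ zeroˡ _ ⟨
    0# * (D * E)                             ∎)

  monicPoch : Carrier → Carrier → ℕ → Carrier
  monicPoch x q zero    = 1#
  monicPoch x q (suc n) = monicPoch x q n * (x - q ^ n)

  poch-*-^≈monicPoch : ∀ x y q n → x * y ≈ 1# → poch x q n * y ^ n ≈ monicPoch y q n
  poch-*-^≈monicPoch x y q zero    xy≈1 = *-identityˡ 1#
  poch-*-^≈monicPoch x y q (suc n) xy≈1 = begin
    (poch x q n * (1# - x * q ^ n)) * (y ^ n * y)
      ≈⟨ solve 5 (λ P x qn Y y → (P :* (:1 :- x :* qn)) :* (Y :* y) := (P :* Y) :* (y :- (x :* y) :* qn)) refl (poch x q n) x (q ^ n) (y ^ n) y ⟩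
    (poch x q n * y ^ n) * (y - (x * y) * q ^ n)
      ≈⟨ *-cong (poch-*-^≈monicPoch x y q n xy≈1) (+-congˡ (-‿cong (trans (*-congʳ xy≈1) (*-identityˡ _)))) ⟩
    monicPoch y q n * (y - q ^ n) ∎

module TerminatingSum {ℓ₁ ℓ₂} (F : Field ℓ₁ ℓ₂) (w E p : Field.Carrier F) where
  open FieldProperties F

  A : Carrier
  A = w * E

  summand : ℕ → ℕ → ℕ → Carrier
  summand L s v =
    (poch w p s * poch A p s * (1# - A * (p ^ s * p ^ s)) * poch E p (s +ℕ L) * monicPoch w p v)
      * (poch p p s * poch (E * p) p s * poch (A * p) p (s +ℕ L) * poch p p v) ⁻¹

  closingFactor : ℕ → Carrier
  closingFactor L = (1# - E * p ^ L) * (1# - p ^ L)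

  -- closed form of  Σ_{s ≤ t} summand L s (L ∸ s)  when  t + 1 + u = L
  partialSum : ℕ → ℕ → ℕ → Carrier
  partialSum L t u =
    ((1# - A) * (poch (w * p) p t * poch (A * p) p t * poch E p (suc t +ℕ L) * monicPoch w p (suc u)))
      * (closingFactor L * (poch p p t * poch (E * p) p t * poch (A * p) p (t +ℕ L) * poch p p u)) ⁻¹

  record DenominatorsNZ (L : ℕ) : Set ℓ₂ where
    field
      p-poch≉0  : NZ (poch p p L)
      Ep-poch≉0 : NZ (poch (E * p) p L)
      Ap-poch≉0 : NZ (poch (A * p) p (L +ℕ L))

  NZ-closingFactor : ∀ M → DenominatorsNZ (suc M) → NZ (closingFactor (suc M))
  NZ-closingFactor M nz = NZ-* (NZ-resp-≈ (+-congˡ (-‿cong (solve 3 (λ E p a → (E :* p) :* a := E :* (a :* p)) refl E p (p ^ M))))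
                                 (NZ-poch-factor (E * p) p (ℕ.n<1+n M) Ep-poch≉0))
                      (NZ-resp-≈ (+-congˡ (-‿cong (*-comm _ _))) (NZ-poch-factor p p (ℕ.n<1+n M) p-poch≉0))
    where open DenominatorsNZ nz

  step-numerators : ∀ x y Λ T → Λ ≈ (x * (y * p)) * p → T ≈ x * Λ →
    (w - y * p) * ((1# - p * x) * (1# - (E * p) * x) * (1# - (A * p) * T))
      + ((1# - w) * (1# - A * ((x * p) * (x * p)))) * ((1# - E * Λ) * (1# - Λ))
    ≈ ((1# - (w * p) * x) * (1# - (A * p) * x) * (1# - E * (T * p))) * (1# - p * y)
  step-numerators x y Λ T Λ≈ T≈ = begin
    (w - y * p) * ((1# - p * x) * (1# - (E * p) * x) * (1# - (A * p) * T))
      + ((1# - w) * (1# - A * ((x * p) * (x * p)))) * ((1# - E * Λ) * (1# - Λ))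
      ≈⟨ +-cong (*-congˡ (*-congˡ (+-congˡ (-‿cong (*-congˡ T≈′)))))
                (*-congˡ (*-cong (+-congˡ (-‿cong (*-congˡ Λ≈))) (+-congˡ (-‿cong Λ≈)))) ⟩
    (w - y * p) * ((1# - p * x) * (1# - (E * p) * x) * (1# - (A * p) * (x * ((x * (y * p)) * p))))
      + ((1# - w) * (1# - A * ((x * p) * (x * p)))) * ((1# - E * ((x * (y * p)) * p)) * (1# - (x * (y * p)) * p))
      ≈⟨ solve 5 (λ w E p x y →
           (w :- y :* p) :* ((:1 :- p :* x) :* (:1 :- (E :* p) :* x) :* (:1 :- ((w :* E) :* p) :* (x :* ((x :* (y :* p)) :* p))))
             :+ ((:1 :- w) :* (:1 :- (w :* E) :* ((x :* p) :* (x :* p)))) :* ((:1 :- E :* ((x :* (y :* p)) :* p)) :* (:1 :- (x :* (y :* p)) :* p))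
           := ((:1 :- (w :* p) :* x) :* (:1 :- ((w :* E) :* p) :* x) :* (:1 :- E :* ((x :* ((x :* (y :* p)) :* p)) :* p))) :* (:1 :- p :* y))
           refl w E p x y ⟩
    ((1# - (w * p) * x) * (1# - (A * p) * x) * (1# - E * ((x * ((x * (y * p)) * p)) * p))) * (1# - p * y)
      ≈⟨ *-congʳ (*-congˡ (+-congˡ (-‿cong (*-congˡ (*-congʳ (sym T≈′)))))) ⟩
    ((1# - (w * p) * x) * (1# - (A * p) * x) * (1# - E * (T * p))) * (1# - p * y) ∎
    where
    T≈′ : T ≈ x * ((x * (y * p)) * p)
    T≈′ = trans T≈ (*-congˡ Λ≈)

  last-numerators : ∀ x → (1# * (w - 1#)) * ((1# - p * x) * (1# - (E * p) * x) * (1# - (A * p) * (x * (x * p))))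
    + ((1# - w) * (1# - A * ((x * p) * (x * p)))) * ((1# - E * (x * p)) * (1# - x * p)) ≈ 0#
  last-numerators x = solve 4 (λ w E p x →
    (:1 :* (w :- :1)) :* ((:1 :- p :* x) :* (:1 :- (E :* p) :* x) :* (:1 :- ((w :* E) :* p) :* (x :* (x :* p))))
      :+ ((:1 :- w) :* (:1 :- (w :* E) :* ((x :* p) :* (x :* p)))) :* ((:1 :- E :* (x :* p)) :* (:1 :- x :* p))
    := :0) refl w E p x

  module PartialSumStep (t d : ℕ) (nz : DenominatorsNZ (suc (t +ℕ suc d))) where
    open DenominatorsNZ nz

    L : ℕ
    L = suc (t +ℕ suc d)

    x y T u Q C G : Carrier
    x = p ^ t
    y = p ^ d
    T = p ^ (t +ℕ L)
    u = 1# - p * y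
    Q = (1# - p * x) * (1# - (E * p) * x) * (1# - (A * p) * T)
    C = (1# - A) * (poch (w * p) p t * poch (A * p) p t * poch E p (suc t +ℕ L) * monicPoch w p (suc d))
    G = poch p p t * poch (E * p) p t * poch (A * p) p (t +ℕ L) * poch p p d

    t<L : t < L
    t<L = s≤s (ℕ.m≤m+n t (suc d))

    d<L : d < L
    d<L = s≤s (ℕ.≤-trans (ℕ.n≤1+n d) (ℕ.m≤n+m (suc d) t))

    t+L<L+L : t +ℕ L < L +ℕ L
    t+L<L+L = ℕ.+-mono-<-≤ t<L (ℕ.≤-refl {L})

    NZ-G : NZ G
    NZ-G = NZ-* (NZ-* (NZ-* (NZ-poch-≤ p p (ℕ.<⇒≤ t<L) p-poch≉0) (NZ-poch-≤ (E * p) p (ℕ.<⇒≤ t<L) Ep-poch≉0))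
                      (NZ-poch-≤ (A * p) p (ℕ.<⇒≤ t+L<L+L) Ap-poch≉0))
                (NZ-poch-≤ p p (ℕ.<⇒≤ d<L) p-poch≉0)

    NZ-u : NZ u
    NZ-u = NZ-poch-factor p p d<L p-poch≉0

    NZ-Q : NZ Q
    NZ-Q = NZ-* (NZ-* (NZ-poch-factor p p t<L p-poch≉0) (NZ-poch-factor (E * p) p t<L Ep-poch≉0))
                (NZ-poch-factor (A * p) p t+L<L+L Ap-poch≉0)

    closingFactor≉0 : NZ (closingFactor L)
    closingFactor≉0 = NZ-closingFactor (t +ℕ suc d) nz

    partialSum-before : partialSum L t (suc d) ≈ (C * G ⁻¹) * ((w - y * p) * (closingFactor L * u) ⁻¹)
    partialSum-before = factor-fraction NZ-G (NZ-* closingFactor≉0 NZ-u)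
      (solve 6 (λ a W Aa Eb D v → a :* (W :* Aa :* Eb :* (D :* v)) := (a :* (W :* Aa :* Eb :* D)) :* v) refl
         (1# - A) (poch (w * p) p t) (poch (A * p) p t) (poch E p (suc t +ℕ L)) (monicPoch w p (suc d)) (w - y * p))
      (solve 6 (λ Y P Ep Ap Pd u → Y :* (P :* Ep :* Ap :* (Pd :* u)) := (P :* Ep :* Ap :* Pd) :* (Y :* u)) refl
         (closingFactor L) (poch p p t) (poch (E * p) p t) (poch (A * p) p (t +ℕ L)) (poch p p d) u)

    summand-next : summand L (suc t) (suc d) ≈ (C * G ⁻¹) * (((1# - w) * (1# - A * ((x * p) * (x * p)))) * (Q * u) ⁻¹)
    summand-next = factor-fraction NZ-G (NZ-* NZ-Q NZ-u)
      (trans (*-congʳ (*-congʳ (*-congʳ (*-cong (poch-suc w p t) (poch-suc A p t)))))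
        (solve 7 (λ a b W Aa V Eb D → (b :* W) :* (a :* Aa) :* V :* Eb :* D := (a :* (W :* Aa :* Eb :* D)) :* (b :* V)) refl
           (1# - A) (1# - w) (poch (w * p) p t) (poch (A * p) p t) (1# - A * ((x * p) * (x * p))) (poch E p (suc t +ℕ L)) (monicPoch w p (suc d))))
      (solve 8 (λ P Ep Ap Pd f g h u → (P :* f) :* (Ep :* g) :* (Ap :* h) :* (Pd :* u) := (P :* Ep :* Ap :* Pd) :* (f :* g :* h :* u)) refl
         (poch p p t) (poch (E * p) p t) (poch (A * p) p (t +ℕ L)) (poch p p d) (1# - p * x) (1# - (E * p) * x) (1# - (A * p) * T) u)

    partialSum-after : partialSum L (suc t) d
      ≈ (C * G ⁻¹) * (((1# - (w * p) * x) * (1# - (A * p) * x) * (1# - E * (T * p))) * (closingFactor L * Q) ⁻¹)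
    partialSum-after = factor-fraction NZ-G (NZ-* closingFactor≉0 NZ-Q)
      (solve 8 (λ a W Aa Eb D f g h → a :* ((W :* f) :* (Aa :* g) :* (Eb :* h) :* D) := (a :* (W :* Aa :* Eb :* D)) :* (f :* g :* h)) refl
         (1# - A) (poch (w * p) p t) (poch (A * p) p t) (poch E p (suc t +ℕ L)) (monicPoch w p (suc d))
         (1# - (w * p) * x) (1# - (A * p) * x) (1# - E * (T * p)))
      (solve 8 (λ Y P Ep Ap Pd f g h → Y :* ((P :* f) :* (Ep :* g) :* (Ap :* h) :* Pd) := (P :* Ep :* Ap :* Pd) :* (Y :* (f :* g :* h))) refl
         (closingFactor L) (poch p p t) (poch (E * p) p t) (poch (A * p) p (t +ℕ L)) (poch p p d) (1# - p * x) (1# - (E * p) * x) (1# - (A * p) * T))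

    partialSum-suc : partialSum L t (suc d) + summand L (suc t) (suc d) ≈ partialSum L (suc t) d
    partialSum-suc = begin
      partialSum L t (suc d) + summand L (suc t) (suc d)          ≈⟨ +-cong partialSum-before summand-next ⟩
      (C * G ⁻¹) * (_ * (closingFactor L * u) ⁻¹) + (C * G ⁻¹) * (_ * (Q * u) ⁻¹) ≈⟨ distribˡ _ _ _ ⟨
      (C * G ⁻¹) * (_ * (closingFactor L * u) ⁻¹ + _ * (Q * u) ⁻¹)       ≈⟨ *-congˡ (add-fractions closingFactor≉0 NZ-Q NZ-u
        (step-numerators x y (p ^ L) T (*-congʳ (^-distribˡ-+-* p t (suc d))) (^-distribˡ-+-* p t L))) ⟩
      (C * G ⁻¹) * (_ * (closingFactor L * Q) ⁻¹)                        ≈⟨ partialSum-after ⟨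
      partialSum L (suc t) d                                    ∎

  partialSum-zero : ∀ M → DenominatorsNZ (suc M) → summand (suc M) 0 (suc M) ≈ partialSum (suc M) 0 M
  partialSum-zero M nz = cross-multiply den≉0 den′≉0
    (solve 8 (λ A Eb D E P p Ap Pm →
         (:1 :* :1 :* (:1 :- A :* (:1 :* :1)) :* Eb :* D) :* ((:1 :- E :* (P :* p)) :* (:1 :- P :* p) :* (:1 :* :1 :* Ap :* Pm))
       := ((:1 :- A) :* (:1 :* :1 :* (Eb :* (:1 :- E :* (P :* p))) :* D)) :* (:1 :* :1 :* Ap :* (Pm :* (:1 :- p :* P)))) refl
       A (poch E p L) (monicPoch w p L) E (p ^ M) p (poch (A * p) p L) (poch p p M))
    where
    open DenominatorsNZ nz
    L : ℕ
    L = suc M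
    NZ-Ap : NZ (poch (A * p) p L)
    NZ-Ap = NZ-poch-≤ (A * p) p (ℕ.m≤m+n L L) Ap-poch≉0
    den≉0 : NZ (poch p p 0 * poch (E * p) p 0 * poch (A * p) p L * poch p p L)
    den≉0 = NZ-* (NZ-* (NZ-* NZ-1 NZ-1) NZ-Ap) p-poch≉0
    den′≉0 : NZ (closingFactor L * (poch p p 0 * poch (E * p) p 0 * poch (A * p) p L * poch p p M))
    den′≉0 = NZ-* (NZ-closingFactor M nz) (NZ-* (NZ-* (NZ-* NZ-1 NZ-1) NZ-Ap) (NZ-poch-≤ p p (ℕ.n≤1+n M) p-poch≉0))

  partialSum-last : ∀ M → DenominatorsNZ (suc M) → partialSum (suc M) M 0 + summand (suc M) (suc M) 0 ≈ 0#
  partialSum-last M nz = begin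
    partialSum L M 0 + summand L L 0                        ≈⟨ +-cong partialSum-M summand-L ⟩
    (C * G ⁻¹) * (_ * closingFactor L ⁻¹) + (C * G ⁻¹) * (_ * Q ⁻¹) ≈⟨ distribˡ _ _ _ ⟨
    (C * G ⁻¹) * (_ * closingFactor L ⁻¹ + _ * Q ⁻¹)                 ≈⟨ *-congˡ (add-fractions-to-zero (NZ-closingFactor M nz) NZ-Q numerators) ⟩
    (C * G ⁻¹) * 0#                                         ≈⟨ zeroʳ _ ⟩
    0#                                                      ∎
    where
    open DenominatorsNZ nz
    L : ℕ
    L = suc M
    x T Q C G : Carrier
    x = p ^ M
    T = p ^ (M +ℕ L)
    Q = (1# - p * x) * (1# - (E * p) * x) * (1# - (A * p) * T)
    C = (1# - A) * (poch (w * p) p M * poch (A * p) p M * poch E p (suc M +ℕ L))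
    G = poch p p M * poch (E * p) p M * poch (A * p) p (M +ℕ L)
    M+L<L+L : M +ℕ L < L +ℕ L
    M+L<L+L = ℕ.+-mono-<-≤ (ℕ.n<1+n M) (ℕ.≤-refl {L})
    NZ-G : NZ G
    NZ-G = NZ-* (NZ-* (NZ-poch-≤ p p (ℕ.n≤1+n M) p-poch≉0) (NZ-poch-≤ (E * p) p (ℕ.n≤1+n M) Ep-poch≉0))
                (NZ-poch-≤ (A * p) p (ℕ.<⇒≤ M+L<L+L) Ap-poch≉0)
    NZ-Q : NZ Q
    NZ-Q = NZ-* (NZ-* (NZ-poch-factor p p (ℕ.n<1+n M) p-poch≉0) (NZ-poch-factor (E * p) p (ℕ.n<1+n M) Ep-poch≉0))
                (NZ-poch-factor (A * p) p M+L<L+L Ap-poch≉0)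
    partialSum-M : partialSum L M 0 ≈ (C * G ⁻¹) * ((1# * (w - 1#)) * closingFactor L ⁻¹)
    partialSum-M = factor-fraction NZ-G (NZ-closingFactor M nz)
      (solve 5 (λ a W Aa Eb v → a :* (W :* Aa :* Eb :* v) := (a :* (W :* Aa :* Eb)) :* v) refl
         (1# - A) (poch (w * p) p M) (poch (A * p) p M) (poch E p (suc M +ℕ L)) (1# * (w - 1#)))
      (solve 4 (λ Y P Ep Ap → Y :* (P :* Ep :* Ap :* :1) := (P :* Ep :* Ap) :* Y) refl
         (closingFactor L) (poch p p M) (poch (E * p) p M) (poch (A * p) p (M +ℕ L)))
    summand-L : summand L L 0 ≈ (C * G ⁻¹) * (((1# - w) * (1# - A * (p ^ L * p ^ L))) * Q ⁻¹)
    summand-L = factor-fraction NZ-G NZ-Q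
      (trans (*-congʳ (*-congʳ (*-congʳ (*-cong (poch-suc w p M) (poch-suc A p M)))))
        (solve 6 (λ a b W Aa V Eb → (b :* W) :* (a :* Aa) :* V :* Eb :* :1 := (a :* (W :* Aa :* Eb)) :* (b :* V)) refl
           (1# - A) (1# - w) (poch (w * p) p M) (poch (A * p) p M) (1# - A * (p ^ L * p ^ L)) (poch E p (suc M +ℕ L))))
      (solve 6 (λ P Ep Ap f g h → (P :* f) :* (Ep :* g) :* (Ap :* h) :* :1 := (P :* Ep :* Ap) :* (f :* g :* h)) refl
         (poch p p M) (poch (E * p) p M) (poch (A * p) p (M +ℕ L)) (1# - p * x) (1# - (E * p) * x) (1# - (A * p) * T))
    numerators : (1# * (w - 1#)) * Q + ((1# - w) * (1# - A * (p ^ L * p ^ L))) * closingFactor L ≈ 0#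
    numerators = trans (+-congʳ (*-congˡ (*-congˡ (+-congˡ (-‿cong (*-congˡ (^-distribˡ-+-* p M L)))))))
                       (last-numerators x)

  sumTo-summand≈partialSum : ∀ M → DenominatorsNZ (suc M) → ∀ t → t ≤ M →
    sumTo t (λ s → summand (suc M) s (suc M ∸ s)) ≈ partialSum (suc M) t (M ∸ t)
  sumTo-summand≈partialSum M nz zero    _    = partialSum-zero M nz
  sumTo-summand≈partialSum M nz (suc t) t<M = begin
    sumTo t (λ s → summand L s (L ∸ s)) + summand L (suc t) (M ∸ t)   ≈⟨ +-congʳ (sumTo-summand≈partialSum M nz t (ℕ.<⇒≤ t<M)) ⟩
    partialSum L t (M ∸ t) + summand L (suc t) (M ∸ t)                ≡⟨ cong (λ v → partialSum L t v + summand L (suc t) v) M∸t≡1+d ⟩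
    partialSum L t (suc d) + summand L (suc t) (suc d)                ≈⟨ step (cong suc M≡t+1+d) nz ⟩
    partialSum L (suc t) d                                            ∎
    where
    L d : ℕ
    L = suc M
    d = M ∸ suc t
    M∸t≡1+d : M ∸ t ≡ suc d
    M∸t≡1+d = ℕ.+-∸-assoc 1 t<M
    M≡t+1+d : M ≡ t +ℕ suc d
    M≡t+1+d = ≡.trans (≡.sym (ℕ.m+[n∸m]≡n (ℕ.<⇒≤ t<M))) (cong (t +ℕ_) M∸t≡1+d)
    step : ∀ {L} → L ≡ suc (t +ℕ suc d) → DenominatorsNZ L →
           partialSum L t (suc d) + summand L (suc t) (suc d) ≈ partialSum L (suc t) d
    step ≡.refl nz = PartialSumStep.partialSum-suc t d nz

  sumTo-summand≈0 : ∀ {L} → 0 < L → DenominatorsNZ L → sumTo L (λ s → summand L s (L ∸ s)) ≈ 0#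
  sumTo-summand≈0 {suc M} _ nz = begin
    sumTo M (λ s → summand L s (L ∸ s)) + summand L L (M ∸ M)   ≈⟨ +-congʳ (sumTo-summand≈partialSum M nz M ℕ.≤-refl) ⟩
    partialSum L M (M ∸ M) + summand L L (M ∸ M)                ≡⟨ cong (λ v → partialSum L M v + summand L L v) (ℕ.n∸n≡0 M) ⟩
    partialSum L M 0 + summand L L 0                            ≈⟨ partialSum-last M nz ⟩
    0#                                                          ∎
    where
    L : ℕ
    L = suc M

module AKFactors {ℓ₁ ℓ₂} (F : Field ℓ₁ ℓ₂) (a k q e c : Field.Carrier F)
  (a≉0 : FieldDefs.NZ F a) (k≉0 : FieldDefs.NZ F k) (q≉0 : FieldDefs.NZ F q) (e≉0 : FieldDefs.NZ F e) where
  open FieldProperties F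

  w z : Carrier
  w = c * e ⁻¹
  z = (q * q * c * a * a) * (k * k * e) ⁻¹

  innerNumer innerDenom : ℕ → ℕ → ℕ → Carrier
  innerNumer u v r = poch (k * a ⁻¹) q u * poch k q v * poch ((q ⁻¹) ^ u) q (2 *ℕ r) * poch (k * q ^ v) q (2 *ℕ r) * z ^ r
  innerDenom u v r = poch q q u * poch (a * q) q v * poch (a * q ^ (v +ℕ 1)) q (2 *ℕ r) * poch (a * q * (q ⁻¹) ^ u * k ⁻¹) q (2 *ℕ r)

  -- innerTerm (n ∸ 2 j) (n + 2 j) r collects the factors of the (j, r)-term of β′_n involving a and k
  innerTerm : ℕ → ℕ → ℕ → Carrier
  innerTerm u v r = innerNumer u v r * innerDenom u v r ⁻¹

  private
    v+2[1+r]≡2+v+2r : ∀ v r → v +ℕ 2 *ℕ suc r ≡ suc (suc v) +ℕ 2 *ℕ r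
    v+2[1+r]≡2+v+2r = solve-∀

  poch-k-shift : ∀ v r → poch k q v * poch (k * q ^ v) q (2 *ℕ suc r)
                       ≈ poch k q (suc (suc v)) * poch (k * q ^ suc (suc v)) q (2 *ℕ r)
  poch-k-shift v r = begin
    poch k q v * poch (k * q ^ v) q (2 *ℕ suc r)                         ≈⟨ poch-+ k q v (2 *ℕ suc r) ⟨
    poch k q (v +ℕ 2 *ℕ suc r)                                           ≡⟨ cong (poch k q) (v+2[1+r]≡2+v+2r v r) ⟩
    poch k q (suc (suc v) +ℕ 2 *ℕ r)                                     ≈⟨ poch-+ k q (suc (suc v)) (2 *ℕ r) ⟩
    poch k q (suc (suc v)) * poch (k * q ^ suc (suc v)) q (2 *ℕ r)       ∎

  poch-aq-+ : ∀ x y → poch (a * q) q (x +ℕ y) ≈ poch (a * q) q x * poch (a * q ^ (x +ℕ 1)) q y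
  poch-aq-+ x y = trans (poch-+ (a * q) q x y) (*-congˡ (poch-cong q y (begin
    (a * q) * q ^ x       ≈⟨ solve 3 (λ a q y → (a :* q) :* y := a :* (y :* (:1 :* q))) refl a q (q ^ x) ⟩
    a * (q ^ x * q ^ 1)   ≈⟨ *-congˡ (^-distribˡ-+-* q x 1) ⟨
    a * q ^ (x +ℕ 1)      ∎)))

  poch-aq-shift : ∀ v r → poch (a * q) q (suc (suc v)) * poch (a * q ^ (suc (suc v) +ℕ 1)) q (2 *ℕ r)
                        ≈ poch (a * q) q v * poch (a * q ^ (v +ℕ 1)) q (2 *ℕ suc r)
  poch-aq-shift v r = begin
    poch (a * q) q (suc (suc v)) * poch (a * q ^ (suc (suc v) +ℕ 1)) q (2 *ℕ r)  ≈⟨ poch-aq-+ (suc (suc v)) (2 *ℕ r) ⟨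
    poch (a * q) q (suc (suc v) +ℕ 2 *ℕ r)                                      ≡⟨ cong (poch (a * q) q) (v+2[1+r]≡2+v+2r v r) ⟨
    poch (a * q) q (v +ℕ 2 *ℕ suc r)                                            ≈⟨ poch-aq-+ v (2 *ℕ suc r) ⟩
    poch (a * q) q v * poch (a * q ^ (v +ℕ 1)) q (2 *ℕ suc r)                   ∎

  q⁻¹q⁻¹qq-cancel : ∀ x → x * q ⁻¹ * q ⁻¹ * q * q ≈ x
  q⁻¹q⁻¹qq-cancel x = begin
    x * q ⁻¹ * q ⁻¹ * q * q          ≈⟨ solve 3 (λ x q′ q → x :* q′ :* q′ :* q :* q := x :* ((q :* q′) :* (q :* q′))) refl x (q ⁻¹) q ⟩
    x * ((q * q ⁻¹) * (q * q ⁻¹))    ≈⟨ *-congˡ (*-cong (⁻¹-inverseʳ q≉0) (⁻¹-inverseʳ q≉0)) ⟩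
    x * (1# * 1#)                    ≈⟨ trans (*-congˡ (*-identityˡ 1#)) (*-identityʳ x) ⟩
    x                                ∎

  poch-q⁻ᵘ-shift : ∀ u r → poch ((q ⁻¹) ^ suc (suc u)) q (2 *ℕ suc r)
    ≈ (1# - (q ⁻¹) ^ suc (suc u)) * ((1# - (q ⁻¹) ^ suc (suc u) * q) * poch ((q ⁻¹) ^ u) q (2 *ℕ r))
  poch-q⁻ᵘ-shift u r = trans (poch-2+ _ q r) (*-congˡ (*-congˡ (poch-cong q (2 *ℕ r) (q⁻¹q⁻¹qq-cancel _))))

  poch-aq⁻ᵘk⁻¹-shift : ∀ u r → poch (a * q * (q ⁻¹) ^ suc (suc u) * k ⁻¹) q (2 *ℕ suc r)
    ≈ (1# - a * q * (q ⁻¹) ^ suc (suc u) * k ⁻¹)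
        * ((1# - a * q * (q ⁻¹) ^ suc (suc u) * k ⁻¹ * q) * poch (a * q * (q ⁻¹) ^ u * k ⁻¹) q (2 *ℕ r))
  poch-aq⁻ᵘk⁻¹-shift u r = trans (poch-2+ _ q r) (*-congˡ (*-congˡ (poch-cong q (2 *ℕ r) (begin
    a * q * ((q ⁻¹) ^ u * q ⁻¹ * q ⁻¹) * k ⁻¹ * q * q
      ≈⟨ solve 5 (λ a q y q′ k′ → a :* q :* (y :* q′ :* q′) :* k′ :* q :* q := a :* q :* (y :* q′ :* q′ :* q :* q) :* k′) refl
           a q ((q ⁻¹) ^ u) (q ⁻¹) (k ⁻¹) ⟩
    a * q * ((q ⁻¹) ^ u * q ⁻¹ * q ⁻¹ * q * q) * k ⁻¹   ≈⟨ *-congʳ (*-congˡ (q⁻¹q⁻¹qq-cancel _)) ⟩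
    a * q * (q ⁻¹) ^ u * k ⁻¹                          ∎))))

  module StepRatio (u : ℕ) where
    y Q₂ R : Carrier
    y = q ^ u
    Q₂ = (q ⁻¹) ^ suc (suc u)
    R = a * q * (q ⁻¹) ^ suc (suc u) * k ⁻¹

    Q₂-inverse : Q₂ * ((y * q) * q) ≈ 1#
    Q₂-inverse = begin
      ((q ⁻¹) ^ u * q ⁻¹ * q ⁻¹) * ((y * q) * q)
        ≈⟨ solve 4 (λ y′ q′ y q → (y′ :* q′ :* q′) :* ((y :* q) :* q) := (y′ :* y) :* ((q :* q′) :* (q :* q′))) refl ((q ⁻¹) ^ u) (q ⁻¹) y q ⟩
      ((q ⁻¹) ^ u * y) * ((q * q ⁻¹) * (q * q ⁻¹))
        ≈⟨ *-cong (⁻¹-^-inverseˡ u q≉0) (*-cong (⁻¹-inverseʳ q≉0) (⁻¹-inverseʳ q≉0)) ⟩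
      1# * (1# * 1#)                              ≈⟨ trans (*-identityˡ _) (*-identityˡ _) ⟩
      1#                                          ∎

    factor-ka : ∀ x → 1# - k * a ⁻¹ * x ≈ a ⁻¹ * (a - k * x)
    factor-ka x = 1-≈-rescale (⁻¹-inverseˡ a≉0) (solve 3 (λ a′ k x → a′ :* (k :* x) := k :* a′ :* x) refl (a ⁻¹) k x)

    factor-Q₂ : 1# - Q₂ ≈ Q₂ * ((y * q) * q - 1#)
    factor-Q₂ = 1-≈-rescale Q₂-inverse (*-identityʳ Q₂)

    factor-Q₂q : 1# - Q₂ * q ≈ (Q₂ * q) * (y * q - 1#)
    factor-Q₂q = 1-≈-rescale (trans (solve 3 (λ Q q y → (Q :* q) :* (y :* q) := Q :* ((y :* q) :* q)) refl Q₂ q y) Q₂-inverse)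
                             (*-identityʳ _)

    factor-R : 1# - R ≈ ((Q₂ * k ⁻¹) * q) * (k * (y * q) - a)
    factor-R = 1-≈-rescale
      (trans (solve 5 (λ Q k′ q k y → ((Q :* k′) :* q) :* (k :* (y :* q)) := (Q :* ((y :* q) :* q)) :* (k′ :* k)) refl Q₂ (k ⁻¹) q k y)
             (trans (*-cong Q₂-inverse (⁻¹-inverseˡ k≉0)) (*-identityˡ 1#)))
      (solve 4 (λ Q k′ q a → ((Q :* k′) :* q) :* a := a :* q :* Q :* k′) refl Q₂ (k ⁻¹) q a)

    factor-Rq : 1# - R * q ≈ (((Q₂ * k ⁻¹) * q) * q) * (k * y - a)
    factor-Rq = 1-≈-rescale
      (trans (solve 5 (λ Q k′ q k y → (((Q :* k′) :* q) :* q) :* (k :* y) := (Q :* ((y :* q) :* q)) :* (k′ :* k)) refl Q₂ (k ⁻¹) q k y)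
             (trans (*-cong Q₂-inverse (⁻¹-inverseˡ k≉0)) (*-identityˡ 1#)))
      (solve 4 (λ Q k′ q a → (((Q :* k′) :* q) :* q) :* a := a :* q :* Q :* k′ :* q) refl Q₂ (k ⁻¹) q a)

    z-expand : z ≈ (q * q * c * a * a) * ((k ⁻¹ * k ⁻¹) * e ⁻¹)
    z-expand = *-congˡ (trans (⁻¹-distrib-* (NZ-* k≉0 k≉0) e≉0) (*-congʳ (⁻¹-distrib-* k≉0 k≉0)))

    step-ratio : (1# - k * a ⁻¹ * y) * (1# - k * a ⁻¹ * (y * q)) * (1# - Q₂) * (1# - Q₂ * q) * z
               ≈ w * ((1# - q * y) * (1# - q * (y * q)) * ((1# - R) * (1# - R * q)))
    step-ratio = begin
      (1# - k * a ⁻¹ * y) * (1# - k * a ⁻¹ * (y * q)) * (1# - Q₂) * (1# - Q₂ * q) * z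
        ≈⟨ *-cong (*-cong (*-cong (*-cong (factor-ka y) (factor-ka (y * q))) factor-Q₂) factor-Q₂q) z-expand ⟩
      (a ⁻¹ * (a - k * y)) * (a ⁻¹ * (a - k * (y * q))) * (Q₂ * ((y * q) * q - 1#)) * ((Q₂ * q) * (y * q - 1#))
        * ((q * q * c * a * a) * ((k ⁻¹ * k ⁻¹) * e ⁻¹))
        ≈⟨ solve 9 (λ a a′ k y q Q c k′ e′ →
             (a′ :* (a :- k :* y)) :* (a′ :* (a :- k :* (y :* q))) :* (Q :* ((y :* q) :* q :- :1)) :* ((Q :* q) :* (y :* q :- :1))
               :* ((q :* q :* c :* a :* a) :* ((k′ :* k′) :* e′))
             := ((a :* a′) :* (a :* a′)) :* ((c :* e′) :* ((:1 :- q :* y) :* (:1 :- q :* (y :* q))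
                  :* ((((Q :* k′) :* q) :* (k :* (y :* q) :- a)) :* ((((Q :* k′) :* q) :* q) :* (k :* y :- a))))))
             refl a (a ⁻¹) k y q Q₂ c (k ⁻¹) (e ⁻¹) ⟩
      ((a * a ⁻¹) * (a * a ⁻¹)) * (w * ((1# - q * y) * (1# - q * (y * q))
        * ((((Q₂ * k ⁻¹) * q) * (k * (y * q) - a)) * ((((Q₂ * k ⁻¹) * q) * q) * (k * y - a)))))
        ≈⟨ trans (*-congʳ (trans (*-cong (⁻¹-inverseʳ a≉0) (⁻¹-inverseʳ a≉0)) (*-identityˡ 1#))) (*-identityˡ _) ⟩
      w * ((1# - q * y) * (1# - q * (y * q)) * ((((Q₂ * k ⁻¹) * q) * (k * (y * q) - a)) * ((((Q₂ * k ⁻¹) * q) * q) * (k * y - a))))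
        ≈⟨ *-congˡ (*-congˡ (*-cong factor-R factor-Rq)) ⟨
      w * ((1# - q * y) * (1# - q * (y * q)) * ((1# - R) * (1# - R * q))) ∎

  innerNumer-step : ∀ u v r → innerNumer (suc (suc u)) v (suc r) * innerDenom u (suc (suc v)) r
                            ≈ (innerNumer u (suc (suc v)) r * w) * innerDenom (suc (suc u)) v (suc r)
  innerNumer-step u v r = begin
    innerNumer (suc (suc u)) v (suc r) * innerDenom u (suc (suc v)) r
      ≈⟨ *-congʳ (*-congʳ (*-congʳ (*-congˡ (poch-q⁻ᵘ-shift u r)))) ⟩
    (Ka * f₁ * f₂ * K * (g₁ * (g₂ * Q)) * Kv * (z ^ r * z)) * (Pu * Av₂ * Av₃ * R′)
      ≈⟨ solve 14 (λ Ka f₁ f₂ K g₁ g₂ Q Kv zr z Pu Av₂ Av₃ R′ →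
            (Ka :* f₁ :* f₂ :* K :* (g₁ :* (g₂ :* Q)) :* Kv :* (zr :* z)) :* (Pu :* Av₂ :* Av₃ :* R′)
            := (Ka :* (K :* Kv) :* Q :* zr :* Pu :* (Av₂ :* Av₃) :* R′) :* (f₁ :* f₂ :* g₁ :* g₂ :* z)) refl
            Ka f₁ f₂ K g₁ g₂ Q Kv (z ^ r) z Pu Av₂ Av₃ R′ ⟩
    (Ka * (K * Kv) * Q * z ^ r * Pu * (Av₂ * Av₃) * R′) * (f₁ * f₂ * g₁ * g₂ * z)
      ≈⟨ *-cong (*-congʳ (*-cong (*-congʳ (*-congʳ (*-congʳ (*-congˡ (poch-k-shift v r))))) (poch-aq-shift v r))) step-ratio ⟩
    (Ka * (K₂ * Kv₂) * Q * z ^ r * Pu * (Av * Av₁) * R′) * (w * (h₁ * h₂ * (b₁ * b₂)))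
      ≈⟨ solve 14 (λ Ka K₂ Kv₂ Q zr Pu Av Av₁ R′ w h₁ h₂ b₁ b₂ →
            (Ka :* (K₂ :* Kv₂) :* Q :* zr :* Pu :* (Av :* Av₁) :* R′) :* (w :* (h₁ :* h₂ :* (b₁ :* b₂)))
            := (Ka :* K₂ :* Q :* Kv₂ :* zr :* w) :* (Pu :* h₁ :* h₂ :* Av :* Av₁ :* (b₁ :* (b₂ :* R′)))) refl
            Ka K₂ Kv₂ Q (z ^ r) Pu Av Av₁ R′ w h₁ h₂ b₁ b₂ ⟩
    (Ka * K₂ * Q * Kv₂ * z ^ r * w) * (Pu * h₁ * h₂ * Av * Av₁ * (b₁ * (b₂ * R′)))
      ≈⟨ *-congˡ (*-congˡ (poch-aq⁻ᵘk⁻¹-shift u r)) ⟨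
    (innerNumer u (suc (suc v)) r * w) * innerDenom (suc (suc u)) v (suc r) ∎
    where
    open StepRatio u
    Ka f₁ f₂ K K₂ g₁ g₂ Q Kv Kv₂ Pu Av Av₁ Av₂ Av₃ R′ h₁ h₂ b₁ b₂ : Carrier
    Ka  = poch (k * a ⁻¹) q u
    f₁  = 1# - k * a ⁻¹ * y
    f₂  = 1# - k * a ⁻¹ * (y * q)
    K   = poch k q v
    K₂  = poch k q (suc (suc v))
    g₁  = 1# - Q₂
    g₂  = 1# - Q₂ * q
    Q   = poch ((q ⁻¹) ^ u) q (2 *ℕ r)
    Kv  = poch (k * q ^ v) q (2 *ℕ suc r)
    Kv₂ = poch (k * q ^ suc (suc v)) q (2 *ℕ r)
    Pu  = poch q q u
    Av  = poch (a * q) q v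
    Av₁ = poch (a * q ^ (v +ℕ 1)) q (2 *ℕ suc r)
    Av₂ = poch (a * q) q (suc (suc v))
    Av₃ = poch (a * q ^ (suc (suc v) +ℕ 1)) q (2 *ℕ r)
    R′  = poch (a * q * (q ⁻¹) ^ u * k ⁻¹) q (2 *ℕ r)
    h₁  = 1# - q * y
    h₂  = 1# - q * (y * q)
    b₁  = 1# - R
    b₂  = 1# - R * q

  innerTerm-step : ∀ {u v u′ v′} r → u ≡ suc (suc u′) → v′ ≡ suc (suc v) →
    NZ (innerDenom u v (suc r)) → NZ (innerDenom u′ v′ r) → innerTerm u v (suc r) ≈ innerTerm u′ v′ r * w
  innerTerm-step {v = v} {u′ = u′} r ≡.refl ≡.refl ≉0 ≉0′ = begin
    innerNumer (suc (suc u′)) v (suc r) * innerDenom (suc (suc u′)) v (suc r) ⁻¹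
      ≈⟨ cross-multiply ≉0 ≉0′ (innerNumer-step u′ v r) ⟩
    (innerNumer u′ (suc (suc v)) r * w) * innerDenom u′ (suc (suc v)) r ⁻¹
      ≈⟨ solve 3 (λ x w y → (x :* w) :* y := (x :* y) :* w) refl _ w _ ⟩
    innerTerm u′ (suc (suc v)) r * w ∎

  innerTerm≈baileyCoeff : ∀ n r j → 2 *ℕ (j +ℕ r) ≤ n →
    (∀ j′ r′ → j′ +ℕ r′ ≡ j +ℕ r → NZ (innerDenom (n ∸ 2 *ℕ j′) (n +ℕ 2 *ℕ j′) r′)) →
    innerTerm (n ∸ 2 *ℕ j) (n +ℕ 2 *ℕ j) r ≈ baileyCoeff a k q n (2 *ℕ (j +ℕ r)) * w ^ r
  innerTerm≈baileyCoeff n zero j _ _ = begin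
    (Ka * K * 1# * 1# * 1#) * (Q * A * 1# * 1#) ⁻¹
      ≈⟨ *-cong (solve 2 (λ a b → a :* b :* :1 :* :1 :* :1 := a :* b) refl Ka K)
                (⁻¹-cong (solve 2 (λ a b → a :* b :* :1 :* :1 := a :* b) refl Q A)) ⟩
    (Ka * K) * (Q * A) ⁻¹                   ≈⟨ *-identityʳ _ ⟨
    baileyCoeff a k q n (2 *ℕ j) * 1#             ≡⟨ cong (λ t → baileyCoeff a k q n (2 *ℕ t) * 1#) (ℕ.+-identityʳ j) ⟨
    baileyCoeff a k q n (2 *ℕ (j +ℕ 0)) * 1#      ∎
    where
    Ka K Q A : Carrier
    Ka = poch (k * a ⁻¹) q (n ∸ 2 *ℕ j)
    K  = poch k q (n +ℕ 2 *ℕ j)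
    Q  = poch q q (n ∸ 2 *ℕ j)
    A  = poch (a * q) q (n +ℕ 2 *ℕ j)
  innerTerm≈baileyCoeff n (suc r) j 2[j+1+r]≤n ≉0 = begin
    innerTerm (n ∸ 2 *ℕ j) (n +ℕ 2 *ℕ j) (suc r)
      ≈⟨ innerTerm-step r n∸2j≡2+n∸2[j+1] n+2[j+1]≡2+n+2j (≉0 j (suc r) ≡.refl) (≉0 (suc j) r j+1+r≡j+[1+r]) ⟩
    innerTerm (n ∸ 2 *ℕ suc j) (n +ℕ 2 *ℕ suc j) r * w
      ≈⟨ *-congʳ (innerTerm≈baileyCoeff n r (suc j) (≡.subst (λ t → 2 *ℕ t ≤ n) (≡.sym j+1+r≡j+[1+r]) 2[j+1+r]≤n)
                                        (λ j′ r′ eq → ≉0 j′ r′ (≡.trans eq j+1+r≡j+[1+r]))) ⟩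
    baileyCoeff a k q n (2 *ℕ (suc j +ℕ r)) * w ^ r * w    ≡⟨ cong (λ t → baileyCoeff a k q n (2 *ℕ t) * w ^ r * w) j+1+r≡j+[1+r] ⟩
    baileyCoeff a k q n (2 *ℕ (j +ℕ suc r)) * w ^ r * w    ≈⟨ *-assoc _ _ _ ⟩
    baileyCoeff a k q n (2 *ℕ (j +ℕ suc r)) * w ^ suc r    ∎
    where
    j+1+r≡j+[1+r] : suc j +ℕ r ≡ j +ℕ suc r
    j+1+r≡j+[1+r] = ≡.sym (ℕ.+-suc j r)
    2+2j≤n : suc (suc (2 *ℕ j)) ≤ n
    2+2j≤n = ≡.subst (_≤ n) (ℕ.*-suc 2 j)
               (ℕ.≤-trans (ℕ.*-monoʳ-≤ 2 (s≤s (ℕ.m≤m+n j r))) (≡.subst (_≤ n) (cong (2 *ℕ_) (ℕ.+-suc j r)) 2[j+1+r]≤n))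
    n∸2j≡2+n∸2[j+1] : n ∸ 2 *ℕ j ≡ suc (suc (n ∸ 2 *ℕ suc j))
    n∸2j≡2+n∸2[j+1] = ≡.trans (ℕ.+-∸-assoc 1 (ℕ.≤-trans (ℕ.n≤1+n _) 2+2j≤n))
                       (cong suc (≡.trans (ℕ.+-∸-assoc 1 2+2j≤n) (cong (λ t → suc (n ∸ t)) (≡.sym (ℕ.*-suc 2 j)))))
    n+2[j+1]≡2+n+2j : n +ℕ 2 *ℕ suc j ≡ suc (suc (n +ℕ 2 *ℕ j))
    n+2[j+1]≡2+n+2j = v+2[1+r]≡2+v+2r n j

module ECFactors {ℓ₁ ℓ₂} (F : Field ℓ₁ ℓ₂) (q e c : Field.Carrier F)
  (e≉0 : FieldDefs.NZ F e) (c≉0 : FieldDefs.NZ F c) where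
  open FieldProperties F

  p w : Carrier
  p = q * q
  w = c * e ⁻¹

  q^2m≈p^m : ∀ m → q ^ (2 *ℕ m) ≈ p ^ m
  q^2m≈p^m m = trans (^-*-assoc q 2 m) (^-cong m (*-congʳ (*-identityˡ q)))

  outerNumᵖ outerDenᵖ : ℕ → Carrier
  outerNumᵖ j = (1# - c * q ^ (4 *ℕ j)) * poch (e * p) p (2 *ℕ j)
  outerDenᵖ j = (1# - c) * poch (c * p) p (2 *ℕ j)

  innerNumᵖ innerDenᵖ : ℕ → ℕ → Carrier
  innerNumᵖ j r = (1# - e * q ^ (4 *ℕ j +ℕ 4 *ℕ r)) * poch (e * c ⁻¹) p r * poch (e * q ^ (4 *ℕ j)) p r
  innerDenᵖ j r = (1# - e * q ^ (4 *ℕ j)) * poch (c * q ^ (4 *ℕ j +ℕ 2)) p r * poch p p r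

  term : ℕ → ℕ → ℕ → Carrier
  term j i r = baileyCoeff e c p j i * (outerNumᵖ j * outerDenᵖ j ⁻¹) * (innerNumᵖ j r * innerDenᵖ j r ⁻¹)

  E A : ℕ → Carrier
  E i = e * p ^ (2 *ℕ i)
  A i = w * E i

  module Summation (i : ℕ) = TerminatingSum F w (E i) p

  prefactor : ℕ → ℕ → Carrier
  prefactor i L = (1# - E i * (p ^ L * p ^ L)) * ((1# - A i) * (1# - E i)) ⁻¹

  c*p^2i≈A : ∀ i → c * p ^ (2 *ℕ i) ≈ A i
  c*p^2i≈A i = begin
    c * p ^ (2 *ℕ i)                    ≈⟨ *-identityʳ _ ⟨
    c * p ^ (2 *ℕ i) * 1#               ≈⟨ *-congˡ (⁻¹-inverseˡ e≉0) ⟨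
    c * p ^ (2 *ℕ i) * (e ⁻¹ * e)       ≈⟨ solve 4 (λ c P e′ e → c :* P :* (e′ :* e) := (c :* e′) :* (e :* P)) refl c (p ^ (2 *ℕ i)) (e ⁻¹) e ⟩
    A i                                 ∎

  [e*c⁻¹]*w≈1 : (e * c ⁻¹) * w ≈ 1#
  [e*c⁻¹]*w≈1 = begin
    (e * c ⁻¹) * (c * e ⁻¹)     ≈⟨ solve 4 (λ e c′ c e′ → (e :* c′) :* (c :* e′) := (e :* e′) :* (c :* c′)) refl e (c ⁻¹) c (e ⁻¹) ⟩
    (e * e ⁻¹) * (c * c ⁻¹)     ≈⟨ *-cong (⁻¹-inverseʳ e≉0) (⁻¹-inverseʳ c≉0) ⟩
    1# * 1#                     ≈⟨ *-identityˡ 1# ⟩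
    1#                          ∎

  module Reindex (i s r : ℕ) where
    j L : ℕ
    j = i +ℕ s
    L = s +ℕ r

    private
      j+i≡2i+s : j +ℕ i ≡ 2 *ℕ i +ℕ s
      j+i≡2i+s = lemma i s where
        lemma : ∀ i s → (i +ℕ s) +ℕ i ≡ 2 *ℕ i +ℕ s
        lemma = solve-∀
      2j≡2i+2s : 2 *ℕ j ≡ 2 *ℕ i +ℕ 2 *ℕ s
      2j≡2i+2s = ℕ.*-distribˡ-+ 2 i s
      2s+r≡s+L : 2 *ℕ s +ℕ r ≡ s +ℕ L
      2s+r≡s+L = lemma s r where
        lemma : ∀ s r → 2 *ℕ s +ℕ r ≡ s +ℕ (s +ℕ r)
        lemma = solve-∀

    q^4j≈ : q ^ (4 *ℕ j) ≈ p ^ (2 *ℕ i) * p ^ (2 *ℕ s)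
    q^4j≈ = trans (reflexive (cong (q ^_) (lemma i s))) (trans (q^2m≈p^m (2 *ℕ i +ℕ 2 *ℕ s)) (^-distribˡ-+-* p (2 *ℕ i) (2 *ℕ s)))
      where
      lemma : ∀ i s → 4 *ℕ (i +ℕ s) ≡ 2 *ℕ (2 *ℕ i +ℕ 2 *ℕ s)
      lemma = solve-∀

    e*q^4j≈ : e * q ^ (4 *ℕ j) ≈ E i * p ^ (2 *ℕ s)
    e*q^4j≈ = trans (*-congˡ q^4j≈) (sym (*-assoc _ _ _))

    poch-w : poch w p (j ∸ i) ≈ poch w p s
    poch-w = reflexive (cong (poch w p) (ℕ.m+n∸m≡n i s))

    poch-p : poch p p (j ∸ i) ≈ poch p p s
    poch-p = reflexive (cong (poch p p) (ℕ.m+n∸m≡n i s))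

    poch-c : poch c p (j +ℕ i) ≈ poch c p (2 *ℕ i) * poch (A i) p s
    poch-c = trans (reflexive (cong (poch c p) j+i≡2i+s)) (trans (poch-+ c p (2 *ℕ i) s) (*-congˡ (poch-cong p s (c*p^2i≈A i))))

    ep*p^2i≈ : (e * p) * p ^ (2 *ℕ i) ≈ E i * p
    ep*p^2i≈ = solve 3 (λ e p P → (e :* p) :* P := (e :* P) :* p) refl e p (p ^ (2 *ℕ i))

    cp*p^2i≈ : (c * p) * p ^ (2 *ℕ i) ≈ A i * p
    cp*p^2i≈ = trans (solve 3 (λ c p P → (c :* p) :* P := (c :* P) :* p) refl c p (p ^ (2 *ℕ i))) (*-congʳ (c*p^2i≈A i))

    poch-ep : poch (e * p) p (j +ℕ i) ≈ poch (e * p) p (2 *ℕ i) * poch (E i * p) p s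
    poch-ep = trans (reflexive (cong (poch (e * p) p) j+i≡2i+s)) (trans (poch-+ (e * p) p (2 *ℕ i) s) (*-congˡ (poch-cong p s ep*p^2i≈)))

    poch-ep-2j : poch (e * p) p (2 *ℕ j) ≈ poch (e * p) p (2 *ℕ i) * poch (E i * p) p (2 *ℕ s)
    poch-ep-2j = trans (reflexive (cong (poch (e * p) p) 2j≡2i+2s))
                       (trans (poch-+ (e * p) p (2 *ℕ i) (2 *ℕ s)) (*-congˡ (poch-cong p (2 *ℕ s) ep*p^2i≈)))

    poch-cp-2j : poch (c * p) p (2 *ℕ j) ≈ poch (c * p) p (2 *ℕ i) * poch (A i * p) p (2 *ℕ s)
    poch-cp-2j = trans (reflexive (cong (poch (c * p) p) 2j≡2i+2s))
                       (trans (poch-+ (c * p) p (2 *ℕ i) (2 *ℕ s)) (*-congˡ (poch-cong p (2 *ℕ s) cp*p^2i≈)))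

    outer-factor : 1# - c * q ^ (4 *ℕ j) ≈ 1# - A i * (p ^ s * p ^ s)
    outer-factor = +-congˡ (-‿cong (begin
      c * q ^ (4 *ℕ j)                           ≈⟨ *-congˡ q^4j≈ ⟩
      c * (p ^ (2 *ℕ i) * p ^ (2 *ℕ s))          ≈⟨ *-assoc _ _ _ ⟨
      (c * p ^ (2 *ℕ i)) * p ^ (2 *ℕ s)          ≈⟨ *-cong (c*p^2i≈A i) (trans (reflexive (cong (p ^_) (lemma s))) (^-distribˡ-+-* p s s)) ⟩
      A i * (p ^ s * p ^ s)                      ∎))
      where
      lemma : ∀ s → 2 *ℕ s ≡ s +ℕ s
      lemma = solve-∀

    inner-factor : 1# - e * q ^ (4 *ℕ j +ℕ 4 *ℕ r) ≈ 1# - E i * (p ^ L * p ^ L)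
    inner-factor = +-congˡ (-‿cong (begin
      e * q ^ (4 *ℕ j +ℕ 4 *ℕ r)                 ≡⟨ cong (λ t → e * q ^ t) (lemma i s r) ⟩
      e * q ^ (2 *ℕ (2 *ℕ i +ℕ (L +ℕ L)))        ≈⟨ *-congˡ (trans (q^2m≈p^m (2 *ℕ i +ℕ (L +ℕ L)))
                                                      (trans (^-distribˡ-+-* p (2 *ℕ i) (L +ℕ L)) (*-congˡ (^-distribˡ-+-* p L L)))) ⟩
      e * (p ^ (2 *ℕ i) * (p ^ L * p ^ L))       ≈⟨ *-assoc _ _ _ ⟨
      E i * (p ^ L * p ^ L)                      ∎))
      where
      lemma : ∀ i s r → 4 *ℕ (i +ℕ s) +ℕ 4 *ℕ r ≡ 2 *ℕ (2 *ℕ i +ℕ ((s +ℕ r) +ℕ (s +ℕ r)))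
      lemma = solve-∀

    poch-c-shifted : poch (c * q ^ (4 *ℕ j +ℕ 2)) p r ≈ poch ((A i * p) * p ^ (2 *ℕ s)) p r
    poch-c-shifted = poch-cong p r (begin
      c * q ^ (4 *ℕ j +ℕ 2)                                ≡⟨ cong (λ t → c * q ^ t) (lemma i s) ⟩
      c * q ^ (2 *ℕ (2 *ℕ i +ℕ (2 *ℕ s +ℕ 1)))             ≈⟨ *-congˡ (trans (q^2m≈p^m (2 *ℕ i +ℕ (2 *ℕ s +ℕ 1)))
                                                               (trans (^-distribˡ-+-* p (2 *ℕ i) (2 *ℕ s +ℕ 1))
                                                                      (*-congˡ (^-distribˡ-+-* p (2 *ℕ s) 1)))) ⟩
      c * (p ^ (2 *ℕ i) * (p ^ (2 *ℕ s) * (1# * p)))       ≈⟨ solve 4 (λ c P Q p → c :* (P :* (Q :* (:1 :* p))) := ((c :* P) :* p) :* Q) refl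
                                                               c (p ^ (2 *ℕ i)) (p ^ (2 *ℕ s)) p ⟩
      ((c * p ^ (2 *ℕ i)) * p) * p ^ (2 *ℕ s)              ≈⟨ *-congʳ (*-congʳ (c*p^2i≈A i)) ⟩
      (A i * p) * p ^ (2 *ℕ s)                             ∎)
      where
      lemma : ∀ i s → 4 *ℕ (i +ℕ s) +ℕ 2 ≡ 2 *ℕ (2 *ℕ i +ℕ (2 *ℕ s +ℕ 1))
      lemma = solve-∀

    poch-E-merge : poch (E i) p (2 *ℕ s) * poch (E i * p ^ (2 *ℕ s)) p r ≈ poch (E i) p (s +ℕ L)
    poch-E-merge = trans (sym (poch-+ (E i) p (2 *ℕ s) r)) (reflexive (cong (poch (E i) p) 2s+r≡s+L))

    poch-Ap-merge : poch (A i * p) p (2 *ℕ s) * poch ((A i * p) * p ^ (2 *ℕ s)) p r ≈ poch (A i * p) p (s +ℕ L)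
    poch-Ap-merge = trans (sym (poch-+ (A i * p) p (2 *ℕ s) r)) (reflexive (cong (poch (A i * p) p) 2s+r≡s+L))

    poch-E-suc : (1# - E i) * poch (E i * p) p (2 *ℕ s) ≈ poch (E i) p (2 *ℕ s) * (1# - E i * p ^ (2 *ℕ s))
    poch-E-suc = sym (poch-suc (E i) p (2 *ℕ s))

    poch-c-suc : poch c p (2 *ℕ i) * (1# - A i) ≈ (1# - c) * poch (c * p) p (2 *ℕ i)
    poch-c-suc = trans (*-congˡ (+-congˡ (-‿cong (sym (c*p^2i≈A i))))) (poch-suc c p (2 *ℕ i))

    NK NS DK DS : Carrier
    NK = 1# - E i * (p ^ L * p ^ L)
    NS = poch w p s * poch (A i) p s * (1# - A i * (p ^ s * p ^ s)) * poch (E i) p (s +ℕ L) * monicPoch w p r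
    DK = (1# - A i) * (1# - E i)
    DS = poch p p s * poch (E i * p) p s * poch (A i * p) p (s +ℕ L) * poch p p r

    ws As c2i b ep2i Ep2s bL Ew ps Eps ApsL pr E2s EsL cp2i Ap2s g Apw rest : Carrier
    ws   = poch w p s
    As   = poch (A i) p s
    c2i  = poch c p (2 *ℕ i)
    b    = 1# - A i * (p ^ s * p ^ s)
    ep2i = poch (e * p) p (2 *ℕ i)
    Ep2s = poch (E i * p) p (2 *ℕ s)
    bL   = 1# - E i * (p ^ L * p ^ L)
    Ew   = poch (E i * p ^ (2 *ℕ s)) p r
    ps   = poch p p s
    Eps  = poch (E i * p) p s
    ApsL = poch (A i * p) p (s +ℕ L)
    pr   = poch p p r
    E2s  = poch (E i) p (2 *ℕ s)
    EsL  = poch (E i) p (s +ℕ L)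
    cp2i = poch (c * p) p (2 *ℕ i)
    Ap2s = poch (A i * p) p (2 *ℕ s)
    g    = 1# - E i * p ^ (2 *ℕ s)
    Apw  = poch ((A i * p) * p ^ (2 *ℕ s)) p r
    rest = ws * As * b * ep2i * bL * monicPoch w p r * ps * Eps * Ap2s * Apw * pr

    cross-multiplied :
      (w ^ r * (poch w p (j ∸ i) * poch c p (j +ℕ i)) * outerNumᵖ j * innerNumᵖ j r) * (DK * DS)
        ≈ (NK * NS) * ((poch p p (j ∸ i) * poch (e * p) p (j +ℕ i)) * outerDenᵖ j * innerDenᵖ j r)
    cross-multiplied = begin
      (w ^ r * (o₁ * o₂) * (o₃ * o₄) * (o₅ * o₆ * o₇)) * (DK * DS)
        ≈⟨ solve 14 (λ wr o₁ o₂ o₃ o₄ o₅ o₆ o₇ a e ps Eps ApsL pr →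
             (wr :* (o₁ :* o₂) :* (o₃ :* o₄) :* (o₅ :* o₆ :* o₇)) :* ((a :* e) :* (ps :* Eps :* ApsL :* pr))
             := o₁ :* (o₂ :* (o₃ :* (o₄ :* (o₅ :* ((o₆ :* wr) :* (o₇ :* (a :* (e :* (ps :* (Eps :* (ApsL :* pr)))))))))))) refl
             (w ^ r) o₁ o₂ o₃ o₄ o₅ o₆ o₇ (1# - A i) (1# - E i) ps Eps ApsL pr ⟩
      o₁ * (o₂ * (o₃ * (o₄ * (o₅ * ((o₆ * w ^ r) * (o₇ * ((1# - A i) * ((1# - E i) * (ps * (Eps * (ApsL * pr)))))))))))
        ≈⟨ *-cong poch-w (*-cong poch-c (*-cong outer-factor (*-cong poch-ep-2j (*-cong inner-factor
             (*-cong (poch-*-^≈monicPoch (e * c ⁻¹) w p r [e*c⁻¹]*w≈1) (*-cong (poch-cong p r e*q^4j≈)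
               (*-congˡ (*-congˡ (*-congˡ (*-congˡ (*-congʳ (sym poch-Ap-merge)))))))))))) ⟩
      ws * ((c2i * As) * (b * ((ep2i * Ep2s) * (bL * (monicPoch w p r * (Ew * ((1# - A i) * ((1# - E i) * (ps * (Eps * ((Ap2s * Apw) * pr)))))))))))
        ≈⟨ solve 16 (λ ws c2i As b ep2i Ep2s bL mw Ew a e ps Eps Ap2s Apw pr →
             ws :* ((c2i :* As) :* (b :* ((ep2i :* Ep2s) :* (bL :* (mw :* (Ew :* (a :* (e :* (ps :* (Eps :* ((Ap2s :* Apw) :* pr)))))))))))
             := (c2i :* a) :* ((e :* Ep2s) :* (Ew :* (ws :* As :* b :* ep2i :* bL :* mw :* ps :* Eps :* Ap2s :* Apw :* pr)))) refl
             ws c2i As b ep2i Ep2s bL (monicPoch w p r) Ew (1# - A i) (1# - E i) ps Eps Ap2s Apw pr ⟩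
      (c2i * (1# - A i)) * (((1# - E i) * Ep2s) * (Ew * rest))
        ≈⟨ *-cong poch-c-suc (*-congʳ poch-E-suc) ⟩
      ((1# - c) * cp2i) * ((E2s * g) * (Ew * rest))
        ≈⟨ solve 6 (λ c′ cp2i E2s g Ew rest → (c′ :* cp2i) :* ((E2s :* g) :* (Ew :* rest)) := (E2s :* Ew) :* (c′ :* cp2i :* g :* rest)) refl
             (1# - c) cp2i E2s g Ew rest ⟩
      (E2s * Ew) * ((1# - c) * cp2i * g * rest)
        ≈⟨ *-congʳ poch-E-merge ⟩
      EsL * ((1# - c) * cp2i * g * rest)
        ≈⟨ solve 15 (λ EsL c′ cp2i g ws As b ep2i bL mw ps Eps Ap2s Apw pr →
             EsL :* (c′ :* cp2i :* g :* (ws :* As :* b :* ep2i :* bL :* mw :* ps :* Eps :* Ap2s :* Apw :* pr))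
             := (bL :* (ws :* As :* b :* EsL :* mw)) :* ((ps :* (ep2i :* Eps)) :* (c′ :* (cp2i :* Ap2s)) :* (g :* Apw :* pr))) refl
             EsL (1# - c) cp2i g ws As b ep2i bL (monicPoch w p r) ps Eps Ap2s Apw pr ⟩
      (NK * NS) * ((ps * (ep2i * Eps)) * ((1# - c) * (cp2i * Ap2s)) * (g * Apw * pr))
        ≈⟨ *-congˡ (*-cong (*-cong (*-cong poch-p poch-ep) (*-congˡ poch-cp-2j)) (*-cong (*-cong (+-congˡ (-‿cong e*q^4j≈)) poch-c-shifted) refl)) ⟨
      (NK * NS) * ((poch p p (j ∸ i) * poch (e * p) p (j +ℕ i)) * outerDenᵖ j * innerDenᵖ j r) ∎
      where
      o₁ o₂ o₃ o₄ o₅ o₆ o₇ : Carrier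
      o₁ = poch w p (j ∸ i)
      o₂ = poch c p (j +ℕ i)
      o₃ = 1# - c * q ^ (4 *ℕ j)
      o₄ = poch (e * p) p (2 *ℕ j)
      o₅ = 1# - e * q ^ (4 *ℕ j +ℕ 4 *ℕ r)
      o₆ = poch (e * c ⁻¹) p r
      o₇ = poch (e * q ^ (4 *ℕ j)) p r

  normalise : ∀ i s r → let open Reindex i s r in
    NZ (poch p p (j ∸ i) * poch (e * p) p (j +ℕ i)) → NZ (outerDenᵖ j) → NZ (innerDenᵖ j r) → NZ DK → NZ DS →
    w ^ r * term j i r ≈ prefactor i L * Summation.summand i L s r
  normalise i s r B≉0 O≉0 I≉0 DK≉0 DS≉0 = begin
    w ^ r * (Bn * B ⁻¹ * (On * O ⁻¹) * (In * I ⁻¹))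
      ≈⟨ solve 7 (λ y a b c d e f → y :* (a :* b :* (c :* d) :* (e :* f)) := (y :* a :* c :* e) :* ((b :* d) :* f)) refl
           (w ^ r) Bn (B ⁻¹) On (O ⁻¹) In (I ⁻¹) ⟩
    (w ^ r * Bn * On * In) * ((B ⁻¹ * O ⁻¹) * I ⁻¹)
      ≈⟨ *-congˡ (trans (⁻¹-distrib-* (NZ-* B≉0 O≉0) I≉0) (*-congʳ (⁻¹-distrib-* B≉0 O≉0))) ⟨
    (w ^ r * Bn * On * In) * (B * O * I) ⁻¹
      ≈⟨ cross-multiply (NZ-* (NZ-* B≉0 O≉0) I≉0) (NZ-* DK≉0 DS≉0) cross-multiplied ⟩
    (NK * NS) * (DK * DS) ⁻¹
      ≈⟨ fraction-*-fraction DK≉0 DS≉0 ⟨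
    prefactor i L * Summation.summand i L s r ∎
    where
    open Reindex i s r
    Bn B On O In I : Carrier
    Bn = poch w p (j ∸ i) * poch c p (j +ℕ i)
    B  = poch p p (j ∸ i) * poch (e * p) p (j +ℕ i)
    On = outerNumᵖ j
    O  = outerDenᵖ j
    In = innerNumᵖ j r
    I  = innerDenᵖ j r

module Main {ℓ₁ ℓ₂} (F : Field ℓ₁ ℓ₂) where
  open FieldProperties F

  module Proof
    (α β : ℕ → Carrier → Carrier → Carrier → Carrier)
    (bailey : ∀ a k q n → RelGeneric a k q n → BaileyRel α β a k q n)
    (g : ℕ → Carrier) (e c a k q : Carrier) (n : ℕ)
    (q≉0 : NZ q) (k≉0 : NZ k) (e≉0 : NZ e) (c≉0 : NZ c) (a≉0 : NZ a)
    (generic : ∀ j → j ≤ n /ℕ 2 → RelGeneric e c (q * q) j)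
    (outerDen≉0 : ∀ j → j ≤ n /ℕ 2 → NZ (outerDen e c a k q n j))
    (innerDen≉0 : ∀ j r → j ≤ n /ℕ 2 → r ≤ n /ℕ 2 ∸ j → NZ (innerDen e c a k q n j r))
    where
    module AK = AKFactors F a k q e c a≉0 k≉0 q≉0 e≉0
    module EC = ECFactors F q e c e≉0 c≉0
    open EC using (p)

    N : ℕ
    N = n /ℕ 2

    α′ : ℕ → Carrier
    α′ i = α i e c p

    outerNum : ℕ → Carrier
    outerNum j = (1# - c * q ^ (4 *ℕ j)) * poch (k * a ⁻¹) q (n ∸ 2 *ℕ j) * poch k q (n +ℕ 2 *ℕ j) * poch (e * p) p (2 *ℕ j)
    innerNum : ℕ → ℕ → Carrier
    innerNum j r = (1# - e * q ^ (4 *ℕ j +ℕ 4 *ℕ r)) * poch ((q ⁻¹) ^ (n ∸ 2 *ℕ j)) q (2 *ℕ r) * poch (k * q ^ (n +ℕ 2 *ℕ j)) q (2 *ℕ r)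
                     * poch (e * c ⁻¹) p r * poch (e * q ^ (4 *ℕ j)) p r

    -- the coefficient of α′ i g (j + r) once β_j is expanded in  βPrime
    tripleTerm : ℕ → ℕ → ℕ → Carrier
    tripleTerm j i r = baileyCoeff e c p j i * (outerNum j * outerDen e c a k q n j ⁻¹)
                         * (innerNum j r * innerDen e c a k q n j r ⁻¹ * AK.z ^ r)

    tripleTerm-factors : ∀ j i r → NZ (outerDen e c a k q n j) → NZ (innerDen e c a k q n j r) →
      tripleTerm j i r ≈ AK.innerTerm (n ∸ 2 *ℕ j) (n +ℕ 2 *ℕ j) r * EC.term j i r
    tripleTerm-factors j i r Od≉0 Id≉0 = begin
      B * ((o₅ * U₁ * U₂ * o₆) * (o₇ * D₁ * D₂ * o₈) ⁻¹) * ((o₉ * U₃ * U₄ * o₁₀ * o₁₁) * (o₁₂ * D₃ * D₄ * o₁₃ * o₁₄) ⁻¹ * z)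
        ≈⟨ *-cong (*-congˡ (*-congˡ (⁻¹-distrib-*₄ Od≉0))) (*-congʳ (*-congˡ (⁻¹-distrib-*₅ Id≉0))) ⟩
      B * ((o₅ * U₁ * U₂ * o₆) * (o₇ ⁻¹ * D₁ ⁻¹ * D₂ ⁻¹ * o₈ ⁻¹))
        * ((o₉ * U₃ * U₄ * o₁₀ * o₁₁) * (o₁₂ ⁻¹ * D₃ ⁻¹ * D₄ ⁻¹ * o₁₃ ⁻¹ * o₁₄ ⁻¹) * z)
        ≈⟨ solve 20 (λ B o₅ U₁ U₂ o₆ o₇ D₁ D₂ o₈ o₉ U₃ U₄ o₁₀ o₁₁ o₁₂ D₃ D₄ o₁₃ o₁₄ z →
             B :* ((o₅ :* U₁ :* U₂ :* o₆) :* (o₇ :* D₁ :* D₂ :* o₈)) :* ((o₉ :* U₃ :* U₄ :* o₁₀ :* o₁₁) :* (o₁₂ :* D₃ :* D₄ :* o₁₃ :* o₁₄) :* z)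
             := (U₁ :* U₂ :* U₃ :* U₄ :* z) :* (D₁ :* D₂ :* D₃ :* D₄) :* (B :* ((o₅ :* o₆) :* (o₇ :* o₈)) :* ((o₉ :* o₁₀ :* o₁₁) :* (o₁₂ :* o₁₃ :* o₁₄))))
             refl B o₅ U₁ U₂ o₆ (o₇ ⁻¹) (D₁ ⁻¹) (D₂ ⁻¹) (o₈ ⁻¹) o₉ U₃ U₄ o₁₀ o₁₁ (o₁₂ ⁻¹) (D₃ ⁻¹) (D₄ ⁻¹) (o₁₃ ⁻¹) (o₁₄ ⁻¹) z ⟩
      (U₁ * U₂ * U₃ * U₄ * z) * (D₁ ⁻¹ * D₂ ⁻¹ * D₃ ⁻¹ * D₄ ⁻¹)
        * (B * ((o₅ * o₆) * (o₇ ⁻¹ * o₈ ⁻¹)) * ((o₉ * o₁₀ * o₁₁) * (o₁₂ ⁻¹ * o₁₃ ⁻¹ * o₁₄ ⁻¹)))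
        ≈⟨ *-cong (*-congˡ (⁻¹-distrib-*₄ D≉0)) (*-cong (*-congˡ (*-congˡ (⁻¹-distrib-* o₇≉0 o₈≉0))) (*-congˡ (⁻¹-distrib-*₃ o≉0))) ⟨
      AK.innerTerm (n ∸ 2 *ℕ j) (n +ℕ 2 *ℕ j) r * EC.term j i r ∎
      where
      B o₅ U₁ U₂ o₆ o₇ D₁ D₂ o₈ o₉ U₃ U₄ o₁₀ o₁₁ o₁₂ D₃ D₄ o₁₃ o₁₄ z : Carrier
      B   = baileyCoeff e c p j i
      o₅  = 1# - c * q ^ (4 *ℕ j)
      U₁  = poch (k * a ⁻¹) q (n ∸ 2 *ℕ j)
      U₂  = poch k q (n +ℕ 2 *ℕ j)
      o₆  = poch (e * p) p (2 *ℕ j)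
      o₇  = 1# - c
      D₁  = poch q q (n ∸ 2 *ℕ j)
      D₂  = poch (a * q) q (n +ℕ 2 *ℕ j)
      o₈  = poch (c * p) p (2 *ℕ j)
      o₉  = 1# - e * q ^ (4 *ℕ j +ℕ 4 *ℕ r)
      U₃  = poch ((q ⁻¹) ^ (n ∸ 2 *ℕ j)) q (2 *ℕ r)
      U₄  = poch (k * q ^ (n +ℕ 2 *ℕ j)) q (2 *ℕ r)
      o₁₀ = poch (e * c ⁻¹) p r
      o₁₁ = poch (e * q ^ (4 *ℕ j)) p r
      o₁₂ = 1# - e * q ^ (4 *ℕ j)
      D₃  = poch (a * q ^ (n +ℕ 2 *ℕ j +ℕ 1)) q (2 *ℕ r)
      D₄  = poch (a * q * (q ⁻¹) ^ (n ∸ 2 *ℕ j) * k ⁻¹) q (2 *ℕ r)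
      o₁₃ = poch (c * q ^ (4 *ℕ j +ℕ 2)) p r
      o₁₄ = poch p p r
      z   = AK.z ^ r
      o₇≉0 : NZ o₇
      o₇≉0 = NZ-*⇒NZˡ (NZ-*⇒NZˡ (NZ-*⇒NZˡ Od≉0))
      o₈≉0 : NZ o₈
      o₈≉0 = NZ-*⇒NZʳ Od≉0
      D≉0 : NZ (D₁ * D₂ * D₃ * D₄)
      D≉0 = NZ-* (NZ-* (NZ-* (NZ-*⇒NZʳ (NZ-*⇒NZˡ (NZ-*⇒NZˡ Od≉0))) (NZ-*⇒NZʳ (NZ-*⇒NZˡ Od≉0)))
                       (NZ-*⇒NZʳ (NZ-*⇒NZˡ (NZ-*⇒NZˡ (NZ-*⇒NZˡ Id≉0)))))
                 (NZ-*⇒NZʳ (NZ-*⇒NZˡ (NZ-*⇒NZˡ Id≉0)))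
      o≉0 : NZ (o₁₂ * o₁₃ * o₁₄)
      o≉0 = NZ-* (NZ-* (NZ-*⇒NZˡ (NZ-*⇒NZˡ (NZ-*⇒NZˡ (NZ-*⇒NZˡ Id≉0)))) (NZ-*⇒NZʳ (NZ-*⇒NZˡ Id≉0))) (NZ-*⇒NZʳ Id≉0)

    2*≤n : ∀ m → m ≤ N → 2 *ℕ m ≤ n
    2*≤n m m≤N = ℕ.≤-trans (ℕ.*-monoʳ-≤ 2 m≤N) (≡.subst (_≤ n) (ℕ.*-comm (n /ℕ 2) 2) (ℕ.m/n*n≤m n 2))

    NZ-innerDenom : ∀ j r → j ≤ N → r ≤ N ∸ j → NZ (AK.innerDenom (n ∸ 2 *ℕ j) (n +ℕ 2 *ℕ j) r)
    NZ-innerDenom j r j≤N r≤N∸j =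
      NZ-* (NZ-* (NZ-* (NZ-*⇒NZʳ (NZ-*⇒NZˡ (NZ-*⇒NZˡ Od≉0))) (NZ-*⇒NZʳ (NZ-*⇒NZˡ Od≉0)))
                 (NZ-*⇒NZʳ (NZ-*⇒NZˡ (NZ-*⇒NZˡ (NZ-*⇒NZˡ Id≉0)))))
           (NZ-*⇒NZʳ (NZ-*⇒NZˡ (NZ-*⇒NZˡ Id≉0)))
      where
      Od≉0 : NZ (outerDen e c a k q n j)
      Od≉0 = outerDen≉0 j j≤N
      Id≉0 : NZ (innerDen e c a k q n j r)
      Id≉0 = innerDen≉0 j r j≤N r≤N∸j

    NZ-[1-A][1-E] : ∀ i m → i ≤ m → m ≤ N → NZ ((1# - EC.A i) * (1# - EC.E i))
    NZ-[1-A][1-E] i m i≤m m≤N = NZ-* 1-A≉0 1-E≉0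
      where
      Od≉0 : NZ (outerDen e c a k q n m)
      Od≉0 = outerDen≉0 m m≤N
      poch-c≉0 : NZ (poch c p (suc (2 *ℕ m)))
      poch-c≉0 = NZ-resp-≈ (sym (poch-suc c p (2 *ℕ m))) (NZ-* (NZ-*⇒NZˡ (NZ-*⇒NZˡ (NZ-*⇒NZˡ Od≉0))) (NZ-*⇒NZʳ Od≉0))
      1-A≉0 : NZ (1# - EC.A i)
      1-A≉0 = NZ-resp-≈ (+-congˡ (-‿cong (EC.c*p^2i≈A i))) (NZ-poch-factor c p (s≤s (ℕ.*-monoʳ-≤ 2 i≤m)) poch-c≉0)
      4i≡2[2i] : 4 *ℕ i ≡ 2 *ℕ (2 *ℕ i)
      4i≡2[2i] = lemma i where
        lemma : ∀ i → 4 *ℕ i ≡ 2 *ℕ (2 *ℕ i)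
        lemma = solve-∀
      1-E≉0 : NZ (1# - EC.E i)
      1-E≉0 = NZ-resp-≈ (+-congˡ (-‿cong (*-congˡ (trans (reflexive (cong (q ^_) 4i≡2[2i])) (EC.q^2m≈p^m (2 *ℕ i))))))
                        (NZ-*⇒NZˡ (NZ-*⇒NZˡ (NZ-*⇒NZˡ (NZ-*⇒NZˡ (innerDen≉0 i 0 (ℕ.≤-trans i≤m m≤N) z≤n)))))

    denominatorsNZ : ∀ i m → i ≤ m → m ≤ N → EC.Summation.DenominatorsNZ i (m ∸ i)
    denominatorsNZ i m i≤m m≤N = record
      { p-poch≉0  = NZ-*⇒NZˡ B≉0
      ; Ep-poch≉0 = NZ-resp-≈ (poch-cong p L (solve 3 (λ e p P → (e :* p) :* P := (e :* P) :* p) refl e p (p ^ (2 *ℕ i))))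
                      (NZ-*⇒NZʳ (NZ-resp-≈ (trans (reflexive (cong (poch (e * p) p) m+i≡2i+L)) (poch-+ (e * p) p (2 *ℕ i) L)) (NZ-*⇒NZʳ B≉0)))
      ; Ap-poch≉0 = NZ-resp-≈ (poch-cong p (L +ℕ L) (trans (solve 3 (λ c p P → (c :* p) :* P := (c :* P) :* p) refl c p (p ^ (2 *ℕ i)))
                                                          (*-congʳ (EC.c*p^2i≈A i))))
                      (NZ-*⇒NZʳ (NZ-resp-≈ (trans (reflexive (cong (poch (c * p) p) 2m≡2i+2L)) (poch-+ (c * p) p (2 *ℕ i) (L +ℕ L)))
                                           (NZ-*⇒NZʳ (outerDen≉0 m m≤N))))
      }
      where
      L : ℕ
      L = m ∸ i
      B≉0 : NZ (poch p p (m ∸ i) * poch (e * p) p (m +ℕ i))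
      B≉0 = proj₂ (generic m m≤N) i i≤m
      m≡i+L : m ≡ i +ℕ L
      m≡i+L = ≡.sym (ℕ.m+[n∸m]≡n i≤m)
      m+i≡2i+L : m +ℕ i ≡ 2 *ℕ i +ℕ L
      m+i≡2i+L = ≡.trans (cong (_+ℕ i) m≡i+L) (lemma i L) where
        lemma : ∀ i L → (i +ℕ L) +ℕ i ≡ 2 *ℕ i +ℕ L
        lemma = solve-∀
      2m≡2i+2L : 2 *ℕ m ≡ 2 *ℕ i +ℕ (L +ℕ L)
      2m≡2i+2L = ≡.trans (cong (2 *ℕ_) m≡i+L) (lemma i L) where
        lemma : ∀ i L → 2 *ℕ (i +ℕ L) ≡ 2 *ℕ i +ℕ (L +ℕ L)
        lemma = solve-∀

    tripleTerm≈summand : ∀ m i s → i ≤ m → m ≤ N → s ≤ m ∸ i →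
      tripleTerm (i +ℕ s) i (m ∸ (i +ℕ s))
        ≈ (baileyCoeff a k q n (2 *ℕ m) * EC.prefactor i (m ∸ i)) * EC.Summation.summand i (m ∸ i) s (m ∸ i ∸ s)
    tripleTerm≈summand m i s i≤m m≤N s≤L = begin
      tripleTerm j i r
        ≈⟨ tripleTerm-factors j i r (outerDen≉0 j j≤N) (innerDen≉0 j r j≤N r≤N∸j) ⟩
      AK.innerTerm (n ∸ 2 *ℕ j) (n +ℕ 2 *ℕ j) r * EC.term j i r
        ≈⟨ *-congʳ (AK.innerTerm≈baileyCoeff n r j (≡.subst (λ t → 2 *ℕ t ≤ n) (≡.sym j+r≡m) (2*≤n m m≤N)) innerDenom≉0) ⟩
      (baileyCoeff a k q n (2 *ℕ (j +ℕ r)) * EC.w ^ r) * EC.term j i r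
        ≡⟨ cong (λ t → (baileyCoeff a k q n (2 *ℕ t) * EC.w ^ r) * EC.term j i r) j+r≡m ⟩
      (baileyCoeff a k q n (2 *ℕ m) * EC.w ^ r) * EC.term j i r
        ≈⟨ *-assoc _ _ _ ⟩
      baileyCoeff a k q n (2 *ℕ m) * (EC.w ^ r * EC.term j i r)
        ≈⟨ *-congˡ (EC.normalise i s r (proj₂ (generic j j≤N) i (ℕ.m≤m+n i s)) (NZ-outerDenᵖ (outerDen≉0 j j≤N))
                                    (NZ-innerDenᵖ (innerDen≉0 j r j≤N r≤N∸j)) (NZ-[1-A][1-E] i m i≤m m≤N) DS≉0) ⟩
      baileyCoeff a k q n (2 *ℕ m) * (EC.prefactor i (s +ℕ r) * EC.Summation.summand i (s +ℕ r) s r)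
        ≡⟨ cong₂ (λ X Y → baileyCoeff a k q n (2 *ℕ m) * (EC.prefactor i X * EC.Summation.summand i X s Y)) s+r≡L r≡L∸s ⟩
      baileyCoeff a k q n (2 *ℕ m) * (EC.prefactor i L * EC.Summation.summand i L s (L ∸ s))
        ≈⟨ *-assoc _ _ _ ⟨
      (baileyCoeff a k q n (2 *ℕ m) * EC.prefactor i L) * EC.Summation.summand i L s (L ∸ s) ∎
      where
      j r L : ℕ
      j = i +ℕ s
      r = m ∸ (i +ℕ s)
      L = m ∸ i
      j≤m : j ≤ m
      j≤m = ≡.subst (i +ℕ s ≤_) (ℕ.m+[n∸m]≡n i≤m) (ℕ.+-monoʳ-≤ i s≤L)
      j≤N : j ≤ N
      j≤N = ℕ.≤-trans j≤m m≤N
      j+r≡m : j +ℕ r ≡ m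
      j+r≡m = ℕ.m+[n∸m]≡n j≤m
      r≤N∸j : r ≤ N ∸ j
      r≤N∸j = ℕ.∸-monoˡ-≤ j m≤N
      r≡L∸s : r ≡ L ∸ s
      r≡L∸s = ≡.sym (ℕ.∸-+-assoc m i s)
      s+r≡L : s +ℕ r ≡ L
      s+r≡L = ≡.trans (cong (s +ℕ_) r≡L∸s) (ℕ.m+[n∸m]≡n s≤L)
      innerDenom≉0 : ∀ j′ r′ → j′ +ℕ r′ ≡ j +ℕ r → NZ (AK.innerDenom (n ∸ 2 *ℕ j′) (n +ℕ 2 *ℕ j′) r′)
      innerDenom≉0 j′ r′ eq = NZ-innerDenom j′ r′ (ℕ.≤-trans (ℕ.m≤m+n j′ r′) j′+r′≤N)
                                            (ℕ.m+n≤o⇒m≤o∸n r′ (≡.subst (_≤ N) (ℕ.+-comm j′ r′) j′+r′≤N))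
        where
        j′+r′≤N : j′ +ℕ r′ ≤ N
        j′+r′≤N = ≡.subst (_≤ N) (≡.sym (≡.trans eq j+r≡m)) m≤N
      NZ-outerDenᵖ : NZ (outerDen e c a k q n j) → NZ (EC.outerDenᵖ j)
      NZ-outerDenᵖ ≉0 = NZ-* (NZ-*⇒NZˡ (NZ-*⇒NZˡ (NZ-*⇒NZˡ ≉0))) (NZ-*⇒NZʳ ≉0)
      NZ-innerDenᵖ : NZ (innerDen e c a k q n j r) → NZ (EC.innerDenᵖ j r)
      NZ-innerDenᵖ ≉0 = NZ-* (NZ-* (NZ-*⇒NZˡ (NZ-*⇒NZˡ (NZ-*⇒NZˡ (NZ-*⇒NZˡ ≉0)))) (NZ-*⇒NZʳ (NZ-*⇒NZˡ ≉0))) (NZ-*⇒NZʳ ≉0)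
      open EC.Summation.DenominatorsNZ i (denominatorsNZ i m i≤m m≤N)
      DS≉0 : NZ (EC.Reindex.DS i s r)
      DS≉0 = NZ-* (NZ-* (NZ-* (NZ-poch-≤ p p s≤L p-poch≉0) (NZ-poch-≤ (EC.E i * p) p s≤L Ep-poch≉0))
                        (NZ-poch-≤ (EC.A i * p) p (≡.subst (λ t → s +ℕ t ≤ L +ℕ L) (≡.sym s+r≡L) (ℕ.+-monoˡ-≤ L s≤L)) Ap-poch≉0))
                  (NZ-poch-≤ p p (≡.subst (r ≤_) s+r≡L (ℕ.m≤n+m r s)) p-poch≉0)

    tripleTerms-off-diagonal : ∀ m i → i < m → m ≤ N →
      sumTo (m ∸ i) (λ s → tripleTerm (i +ℕ s) i (m ∸ (i +ℕ s))) ≈ 0#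
    tripleTerms-off-diagonal m i i<m m≤N = begin
      sumTo L (λ s → tripleTerm (i +ℕ s) i (m ∸ (i +ℕ s)))
        ≈⟨ sumTo-cong L (λ s s≤L → tripleTerm≈summand m i s (ℕ.<⇒≤ i<m) m≤N s≤L) ⟩
      sumTo L (λ s → C * EC.Summation.summand i L s (L ∸ s))   ≈⟨ *-distribˡ-sumTo L C _ ⟨
      C * sumTo L (λ s → EC.Summation.summand i L s (L ∸ s))
        ≈⟨ *-congˡ (EC.Summation.sumTo-summand≈0 i (ℕ.m<n⇒0<n∸m i<m) (denominatorsNZ i m (ℕ.<⇒≤ i<m) m≤N)) ⟩
      C * 0#                                                  ≈⟨ zeroʳ C ⟩
      0#                                                      ∎
      where
      L : ℕ
      L = m ∸ i
      C : Carrier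
      C = baileyCoeff a k q n (2 *ℕ m) * EC.prefactor i L

    prefactor*summand-at-0 : ∀ m → m ≤ N → EC.prefactor m 0 * EC.Summation.summand m 0 0 0 ≈ 1#
    prefactor*summand-at-0 m m≤N = begin
      (Ne * D ⁻¹) * (Na * (1# * 1# * 1# * 1#) ⁻¹)
        ≈⟨ *-congˡ (*-congˡ (trans (⁻¹-cong (solve 0 (:1 :* :1 :* :1 :* :1 := :1) refl)) ⁻¹-1)) ⟩
      (Ne * D ⁻¹) * (Na * 1#)
        ≈⟨ solve 3 (λ x d y → (x :* d) :* (y :* :1) := (x :* y) :* d) refl Ne (D ⁻¹) Na ⟩
      (Ne * Na) * D ⁻¹
        ≈⟨ *-congʳ (solve 2 (λ A E → (:1 :- E :* (:1 :* :1)) :* (:1 :* :1 :* (:1 :- A :* (:1 :* :1)) :* :1 :* :1) := (:1 :- A) :* (:1 :- E))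
                            refl (EC.A m) (EC.E m)) ⟩
      D * D ⁻¹
        ≈⟨ ⁻¹-inverseʳ (NZ-[1-A][1-E] m m ℕ.≤-refl m≤N) ⟩
      1# ∎
      where
      Ne Na D : Carrier
      Ne = 1# - EC.E m * (1# * 1#)
      Na = 1# * 1# * (1# - EC.A m * (1# * 1#)) * 1# * 1#
      D  = (1# - EC.A m) * (1# - EC.E m)

    tripleTerms-diagonal : ∀ m → m ≤ N →
      sumTo (m ∸ m) (λ s → tripleTerm (m +ℕ s) m (m ∸ (m +ℕ s))) ≈ baileyCoeff a k q n (2 *ℕ m)
    tripleTerms-diagonal m m≤N = trans (sumTo-cong (m ∸ m) (λ s s≤0 → tripleTerm≈summand m m s ℕ.≤-refl m≤N s≤0))
                                       (at-0 (m ∸ m) (ℕ.n∸n≡0 m))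
      where
      C : Carrier
      C = baileyCoeff a k q n (2 *ℕ m)
      at-0 : ∀ L → L ≡ 0 → sumTo L (λ s → (C * EC.prefactor m L) * EC.Summation.summand m L s (L ∸ s)) ≈ C
      at-0 .0 ≡.refl = trans (*-assoc _ _ _) (trans (*-congˡ (prefactor*summand-at-0 m m≤N)) (*-identityʳ C))

    coefficient-of-α′ : ∀ m → m ≤ N →
      sumTo m (λ i → (α′ i * g m) * sumTo (m ∸ i) (λ s → tripleTerm (i +ℕ s) i (m ∸ (i +ℕ s))))
        ≈ (α′ m * g m) * baileyCoeff a k q n (2 *ℕ m)
    coefficient-of-α′ zero    m≤N = *-congˡ (tripleTerms-diagonal 0 m≤N)
    coefficient-of-α′ (suc m) m≤N = begin
      sumTo m f + f (suc m)
        ≈⟨ +-cong (sumTo-zero m f (λ i i≤m → trans (*-congˡ (tripleTerms-off-diagonal (suc m) i (s≤s i≤m) m≤N)) (zeroʳ _)))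
                  (*-congˡ (tripleTerms-diagonal (suc m) m≤N)) ⟩
      0# + (α′ (suc m) * g (suc m)) * baileyCoeff a k q n (2 *ℕ suc m)  ≈⟨ +-identityˡ _ ⟩
      (α′ (suc m) * g (suc m)) * baileyCoeff a k q n (2 *ℕ suc m)       ∎
      where
      f : ℕ → Carrier
      f i = (α′ i * g (suc m)) * sumTo (suc m ∸ i) (λ s → tripleTerm (i +ℕ s) i (suc m ∸ (i +ℕ s)))

    expand-β : ∀ j → j ≤ N →
      β j e c p * outerNum j * outerDen e c a k q n j ⁻¹
        * sumTo (N ∸ j) (λ r → innerNum j r * g (r +ℕ j) * innerDen e c a k q n j r ⁻¹ * AK.z ^ r)
      ≈ sumTo (N ∸ j) (λ r → sumTo j (λ i → (α′ i * g (r +ℕ j)) * tripleTerm j i r))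
    expand-β j j≤N = begin
      β j e c p * X * D ⁻¹ * sumTo (N ∸ j) Y               ≈⟨ *-congʳ (*-congʳ (*-congʳ (bailey e c p j (generic j j≤N)))) ⟩
      sumTo j Bα * X * D ⁻¹ * sumTo (N ∸ j) Y              ≈⟨ *-distribˡ-sumTo (N ∸ j) _ Y ⟩
      sumTo (N ∸ j) (λ r → sumTo j Bα * X * D ⁻¹ * Y r)    ≈⟨ sumTo-cong (N ∸ j) (λ r _ → expand-r r) ⟩
      sumTo (N ∸ j) (λ r → sumTo j (λ i → (α′ i * g (r +ℕ j)) * tripleTerm j i r)) ∎
      where
      X D : Carrier
      X = outerNum j
      D = outerDen e c a k q n j
      Y : ℕ → Carrier
      Y r = innerNum j r * g (r +ℕ j) * innerDen e c a k q n j r ⁻¹ * AK.z ^ r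
      Bα : ℕ → Carrier
      Bα i = baileyCoeff e c p j i * α′ i
      expand-r : ∀ r → sumTo j Bα * X * D ⁻¹ * Y r ≈ sumTo j (λ i → (α′ i * g (r +ℕ j)) * tripleTerm j i r)
      expand-r r = begin
        sumTo j Bα * X * D ⁻¹ * Y r        ≈⟨ solve 4 (λ S X D Y → S :* X :* D :* Y := S :* (X :* D :* Y)) refl (sumTo j Bα) X (D ⁻¹) (Y r) ⟩
        sumTo j Bα * (X * D ⁻¹ * Y r)      ≈⟨ *-distribʳ-sumTo j _ Bα ⟩
        sumTo j (λ i → Bα i * (X * D ⁻¹ * Y r))
          ≈⟨ sumTo-cong j (λ i _ → solve 8 (λ B a X D N g I z → (B :* a) :* (X :* D :* (N :* g :* I :* z)) := (a :* g) :* (B :* (X :* D) :* (N :* I :* z)))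
                                     refl (baileyCoeff e c p j i) (α′ i) X (D ⁻¹) (innerNum j r) (g (r +ℕ j)) (innerDen e c a k q n j r ⁻¹) (AK.z ^ r)) ⟩
        sumTo j (λ i → (α′ i * g (r +ℕ j)) * tripleTerm j i r) ∎

    bailey-relation : BaileyRel (αPrime g α e c) (βPrime g β e c) a k q n
    bailey-relation = begin
      βPrime g β e c n a k q
        ≈⟨ sumTo-cong N expand-β ⟩
      sumTo N (λ j → sumTo (N ∸ j) (λ r → sumTo j (λ i → (α′ i * g (r +ℕ j)) * tripleTerm j i r)))
        ≈⟨ sumTo-by-antidiagonals N _ ⟩
      sumTo N (λ m → sumTo m (λ j → sumTo j (λ i → (α′ i * g (m ∸ j +ℕ j)) * tripleTerm j i (m ∸ j))))
        ≈⟨ sumTo-cong N (λ m _ → sumTo-triangle-swap m _) ⟩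
      sumTo N (λ m → sumTo m (λ i → sumTo (m ∸ i) (λ s → (α′ i * g (m ∸ (i +ℕ s) +ℕ (i +ℕ s))) * tripleTerm (i +ℕ s) i (m ∸ (i +ℕ s)))))
        ≈⟨ sumTo-cong N (λ m _ → sumTo-cong m (λ i i≤m → collect m i i≤m)) ⟩
      sumTo N (λ m → sumTo m (λ i → (α′ i * g m) * sumTo (m ∸ i) (λ s → tripleTerm (i +ℕ s) i (m ∸ (i +ℕ s)))))
        ≈⟨ sumTo-cong N coefficient-of-α′ ⟩
      sumTo N (λ m → (α′ m * g m) * baileyCoeff a k q n (2 *ℕ m))
        ≈⟨ sumTo-cong N (λ m _ → solve 3 (λ a g C → (a :* g) :* C := C :* (g :* a)) refl (α′ m) (g m) (baileyCoeff a k q n (2 *ℕ m))) ⟩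
      sumTo N (λ m → baileyCoeff a k q n (2 *ℕ m) * (g m * α′ m))
        ≈⟨ sumTo-evenPart n (baileyCoeff a k q n) (λ m → g m * α′ m) ⟨
      sumTo n (λ t → baileyCoeff a k q n t * evenPart t (λ m → g m * α′ m)) ∎
      where
      collect : ∀ m i → i ≤ m →
        sumTo (m ∸ i) (λ s → (α′ i * g (m ∸ (i +ℕ s) +ℕ (i +ℕ s))) * tripleTerm (i +ℕ s) i (m ∸ (i +ℕ s)))
          ≈ (α′ i * g m) * sumTo (m ∸ i) (λ s → tripleTerm (i +ℕ s) i (m ∸ (i +ℕ s)))
      collect m i i≤m = trans
        (sumTo-cong (m ∸ i) (λ s s≤m∸i → *-congʳ (*-congˡ (reflexive (cong g (ℕ.m∸n+n≡m
          (≡.subst (i +ℕ s ≤_) (ℕ.m+[n∸m]≡n i≤m) (ℕ.+-monoʳ-≤ i s≤m∸i))))))))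
        (sym (*-distribˡ-sumTo (m ∸ i) (α′ i * g m) _))

theorem3p7 : ∀ {ℓ₁ ℓ₂} (F : Field ℓ₁ ℓ₂) → let open FieldDefs F in
    (α β : ℕ → Carrier → Carrier → Carrier → Carrier) →
    (∀ a k q n → RelGeneric a k q n → BaileyRel α β a k q n) →
    (g : ℕ → Carrier) (e c : Carrier) →
    ∀ a k q n → PrimeGeneric e c a k q n →
    BaileyRel (αPrime g α e c) (βPrime g β e c) a k q n
theorem3p7 F α β bailey g e c a k q n (q≉0 , k≉0 , e≉0 , c≉0 , (a≉0 , _) , generic , outerDen≉0 , innerDen≉0) =
  Main.Proof.bailey-relation F α β bailey g e c a k q n q≉0 k≉0 e≉0 c≉0 a≉0 generic outerDen≉0 innerDen≉0
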